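{- For any connected finite simple graph $G$ with $9$ vertices and $11$ edges, $\kappa_3(G)=1$.
   Context: For a nontrivial connected graph $G$ and a set $S$ of $3$ vertices of $G$, $\kappa(S)$ denotes the maximum number $\ell$ of edge-disjoint trees $T_1,\dots,T_\ell$ in $G$, each containing all vertices of $S$, such that $V(T_i)\cap V(T_j)=S$ for every pair of distinct $i,j$. The generalized $3$-connectivity is $\kappa_3(G)=\min\{\kappa(S)\}$, the minimum taken over all $3$-subsets $S$ of $V(G)$. -}

module Defs where

open import Data.Nat using (ℕ; _≤_; _<?_)
open import Data.Bool using (Bool; true; false; T?)
open import Data.Fin using (Fin; toℕ)
open import Data.List using (List; []; _∷_; length; filter; cartesianProduct; allFin; _∷ʳ_)
open import Data.List.Relation.Unary.Linked using (Linked)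
open import Data.List.Relation.Unary.Unique.Propositional using (Unique)
open import Data.Product using (Σ; ∃; _×_; _,_; proj₁; proj₂)
open import Data.Sum using (_⊎_)
open import Data.Empty using (⊥)
open import Relation.Binary.PropositionalEquality using (_≡_; _≢_)
open import Relation.Nullary.Decidable using (_×-dec_)

record Graph (n : ℕ) : Set where
  field
    Adj    : Fin n → Fin n → Bool
    sym    : ∀ u v → Adj u v ≡ Adj v u
    irrefl : ∀ v → Adj v v ≡ false
open Graph public

-- Edges: unordered pairs {i,j} represented once with toℕ i < toℕ j.
edgeList : ∀ {n} → Graph n → List (Fin n × Fin n)
edgeList {n} G =
  filter (λ p → (toℕ (proj₁ p) <? toℕ (proj₂ p)) ×-dec T? (Adj G (proj₁ p) (proj₂ p)))
         (cartesianProduct (allFin n) (allFin n))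

numEdges : ∀ {n} → Graph n → ℕ
numEdges G = length (edgeList G)

data Walk {n : ℕ} (E : Fin n → Fin n → Bool) : Fin n → Fin n → Set where
  here : ∀ {u} → Walk E u u
  step : ∀ {u w v} → E u w ≡ true → Walk E w v → Walk E u v

Connected : ∀ {n} → Graph n → Set
Connected G = ∀ u v → Walk (Adj G) u v

-- A cycle in E: distinct vertices x, x₁, …, x_k (k ≥ 2, so at least 3 vertices)
-- with consecutive ones adjacent and x_k adjacent to x.
HasCycle : ∀ {n} → (Fin n → Fin n → Bool) → Set
HasCycle {n} E =
  Σ (Fin n) λ x → Σ (List (Fin n)) λ xs →
    Unique (x ∷ xs) × (2 ≤ length xs) × Linked (λ a b → E a b ≡ true) ((x ∷ xs) ∷ʳ x)

record Tree {n : ℕ} (G : Graph n) : Set where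
  field
    inV       : Fin n → Bool
    inE       : Fin n → Fin n → Bool
    E-sym     : ∀ u v → inE u v ≡ inE v u
    E-sub     : ∀ u v → inE u v ≡ true → Adj G u v ≡ true
    E-ends    : ∀ u v → inE u v ≡ true → inV u ≡ true
    connected : ∀ u v → inV u ≡ true → inV v ≡ true → Walk inE u v
    acyclic   : HasCycle inE → ⊥
open Tree public

record Triple (n : ℕ) : Set where
  constructor triple
  field
    a b c : Fin n
    a≢b : a ≢ b
    a≢c : a ≢ c
    b≢c : b ≢ c
open Triple public

_∈S_ : ∀ {n} → Fin n → Triple n → Set
v ∈S S = v ≡ a S ⊎ v ≡ b S ⊎ v ≡ c S

Packing : ∀ {n} → Graph n → Triple n → ℕ → Set
Packing G S ℓ =
  Σ (Fin ℓ → Tree G) λ T →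
    (∀ i v → v ∈S S → inV (T i) v ≡ true) ×
    (∀ i j → i ≢ j → ∀ u v → inE (T i) u v ≡ true → inE (T j) u v ≡ false) ×
    (∀ i j → i ≢ j → ∀ v → inV (T i) v ≡ true → inV (T j) v ≡ true → v ∈S S)

IsKappa : ∀ {n} → Graph n → Triple n → ℕ → Set
IsKappa G S k = Packing G S k × (∀ m → Packing G S m → m ≤ k)

IsKappa3 : ∀ {n} → Graph n → ℕ → Set
IsKappa3 G k =
  (∃ λ S → IsKappa G S k) × (∀ S k' → IsKappa G S k' → k ≤ k')

-- Every 3-set S gets one S-tree from a spanning tree, so it suffices to exhibit one S for which two
-- S-trees X, Y meeting only in S do not exist.  A vertex s of S with N(s) = {p, q} forces X and Y to
-- leave s through different neighbours, and any other shared edge, or shared vertex outside S, is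
-- forbidden.  This refutes two trees when S contains a vertex of degree at most one, or two adjacent
-- vertices of degree two.  Otherwise degree counting (22 = 2·11 over 9 vertices) leaves exactly five
-- pairwise non-adjacent vertices of degree two and four of degree three: G subdivides five of the six
-- edges of a cubic multigraph on four vertices.  Each of the finitely many such shapes is settled by a
-- certificate, checked by evaluation: three subdivision vertices around a triangle, a vertex s whose two
-- sides are separated by small cuts through s, or a closed proper vertex set contradicting connectivity.
module Submission where

open import Data.Bool using (Bool; true; false; _∧_; _∨_; not; if_then_else_; T)
import Data.Bool as Bool
open import Data.Bool.Properties using (∨-comm)
open import Data.Empty using (⊥; ⊥-elim)
open import Data.Fin using (Fin; zero; suc; _≟_; toℕ; cast; _↑ˡ_; _↑ʳ_; splitAt; join)
open import Data.Fin.Patterns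
open import Data.Fin.Permutation using (permutation)
open import Data.Fin.Properties
  using (any?; all?; toℕ-injective; cast-involutive; join-splitAt; splitAt-↑ˡ; splitAt-↑ʳ)
open import Data.List using (List; []; _∷_; length; _++_; _∷ʳ_; map; filter; cartesianProduct; allFin; tabulate)
import Data.List as List
open import Data.List.Membership.Propositional using (_∈_)
open import Data.List.Membership.Propositional.Properties using (∈-lookup; ∈-filter⁺; ∈-filter⁻; ∈-allFin)
open import Data.List.Properties using (map-++; map-∘)
open import Data.List.Relation.Unary.All using (All; []; _∷_)
import Data.List.Relation.Unary.All as All
import Data.List.Relation.Unary.All.Properties as All
open import Data.List.Relation.Unary.AllPairs using ([]; _∷_)
open import Data.List.Relation.Unary.Any using (here; there)
import Data.List.Relation.Unary.Any as Any
open import Data.List.Relation.Unary.Any.Properties using (lookup-index)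
open import Data.List.Relation.Unary.Linked as Linked using (Linked; _∷_)
open import Data.List.Relation.Unary.Unique.Propositional using (Unique)
import Data.List.Relation.Unary.Unique.Propositional.Properties as Unique
open import Data.Nat
  using (ℕ; zero; suc; _+_; _*_; _∸_; _≤_; _<_; _≤?_; _<?_; _<ᵇ_; _≡ᵇ_; _≤ᵇ_; z≤n; s≤s; s≤s⁻¹; pred)
import Data.Nat as ℕ
open import Data.Nat.ListAction using () renaming (sum to sumᴸ)
open import Data.Nat.ListAction.Properties using () renaming (sum-++ to sumᴸ-++)
open import Data.Nat.Properties
  using (≤-refl; ≤-trans; ≤-reflexive; ≤-antisym; <-trans; <-irrefl; <-≤-trans; <-asym; n<1+n; n≮0; ≮⇒≥; ≰⇒>;
         +-identityʳ; +-assoc; +-mono-≤; +-monoʳ-≤; +-cancelˡ-≤; +-cancelʳ-≤; +-cancelˡ-≡; *-monoʳ-≤; m≤m+n;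
         m+n∸m≡n; <ᵇ⇒<; <⇒<ᵇ; ≡ᵇ⇒≡; ≡⇒≡ᵇ; ≤⇒≤ᵇ; +-*-semiring; module ≤-Reasoning)
open import Algebra.Properties.Semiring.Sum +-*-semiring
  using (sum-syntax; sum-cong-≗; ∑-distrib-+; ∑-comm; ∑-permute; *-distribˡ-sum)
open import Data.Product using (Σ; ∃; ∃₂; _×_; _,_; proj₁; proj₂)
open import Data.Product.Properties using () renaming (≡-dec to ×-≡-dec)
open import Data.Sum using (_⊎_; inj₁; inj₂; [_,_]′) renaming (swap to ⊎-swap)
open import Data.Unit using (⊤; tt)
open import Data.Vec using (Vec; []; _∷_; lookup)
import Data.Vec as Vec
open import Data.Vec.Properties using (lookup∘tabulate)
open import Relation.Binary.PropositionalEquality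
  using (_≡_; _≢_; ≢-sym; refl; sym; trans; cong; cong₂; subst; subst₂; module ≡-Reasoning)
open import Relation.Nullary using (¬_; Dec; does; yes; no)
open import Relation.Nullary.Decidable using (_×-dec_; _⊎-dec_; _→-dec_; ¬?; T?; dec-true; dec-false)

open import Defs renaming (sym to Adj-sym; irrefl to Adj-irrefl)

private
  variable
    n : ℕ

Adjacency : ℕ → Set
Adjacency n = Fin n → Fin n → Bool

_==_ : Fin n → Fin n → Bool
x == y = does (x ≟ y)

==⇒≡ : {x y : Fin n} → (x == y) ≡ true → x ≡ y
==⇒≡ {x = x} {y} eq with x ≟ y
... | yes x≡y = x≡y

≡⇒== : {x y : Fin n} → x ≡ y → (x == y) ≡ true
≡⇒== {x = x} {y} = dec-true (x ≟ y)

==-refl : (x : Fin n) → (x == x) ≡ true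
==-refl x = ≡⇒== {x = x} refl

≢⇒==-false : {x y : Fin n} → x ≢ y → (x == y) ≡ false
≢⇒==-false {x = x} {y} = dec-false (x ≟ y)

dec-true⁻¹ : ∀ {P : Set} (P? : Dec P) → does P? ≡ true → P
dec-true⁻¹ (yes p) _ = p

true≢false : true ≢ false
true≢false ()

T-true : ∀ {b} → b ≡ true → T b
T-true refl = tt

T⇒true : ∀ {b} → T b → b ≡ true
T⇒true {true} _ = refl

∧-true : ∀ {a b} → (a ∧ b) ≡ true → a ≡ true × b ≡ true
∧-true {true} {true} _ = refl , refl

∨-true : ∀ {a b} → (a ∨ b) ≡ true → a ≡ true ⊎ b ≡ true
∨-true {true} _ = inj₁ refl
∨-true {false} b≡true = inj₂ b≡true

∨-trueˡ : ∀ {a b} → a ≡ true → (a ∨ b) ≡ true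
∨-trueˡ refl = refl

∨-trueʳ : ∀ a {b} → b ≡ true → (a ∨ b) ≡ true
∨-trueʳ true _ = refl
∨-trueʳ false b≡true = b≡true

∨-false : ∀ {a b} → a ≡ false → b ≡ false → (a ∨ b) ≡ false
∨-false refl refl = refl

choose : ∀ {P : Fin n → Set} → (∀ v → Dec (P v)) → Fin n → Fin n
choose P? default with any? P?
... | yes (v , _) = v
... | no _ = default

choose-spec : ∀ {P : Fin n → Set} (P? : ∀ v → Dec (P v)) default → (∃ λ v → P v) → P (choose P? default)
choose-spec P? default ∃P with any? P?
... | yes (_ , Pv) = Pv
... | no ¬∃P = ⊥-elim (¬∃P ∃P)

allᵇ : (Fin n → Bool) → Bool
allᵇ {zero} f = true
allᵇ {suc n} f = f zero ∧ allᵇ (λ i → f (suc i))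

allᵇ-sound : (f : Fin n → Bool) → allᵇ f ≡ true → ∀ i → f i ≡ true
allᵇ-sound f all zero = proj₁ (∧-true all)
allᵇ-sound f all (suc i) = allᵇ-sound (λ j → f (suc j)) (proj₂ (∧-true {f zero} all)) i

allᵇ-complete : (f : Fin n → Bool) → (∀ i → f i ≡ true) → allᵇ f ≡ true
allᵇ-complete {zero} f _ = refl
allᵇ-complete {suc n} f all with f zero in f₀
... | true = allᵇ-complete (λ j → f (suc j)) (λ j → all (suc j))
... | false = trans (sym f₀) (all zero)

allBoolVecs : ∀ n → (Vec Bool n → Bool) → Bool
allBoolVecs zero k = k []
allBoolVecs (suc n) k = allBoolVecs n (λ v → k (true ∷ v)) ∧ allBoolVecs n (λ v → k (false ∷ v))

allBoolVecs-sound : ∀ n (k : Vec Bool n → Bool) → allBoolVecs n k ≡ true → ∀ v → k v ≡ true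
allBoolVecs-sound zero k all [] = all
allBoolVecs-sound (suc n) k all (true ∷ v) = allBoolVecs-sound n (λ v → k (true ∷ v)) (proj₁ (∧-true all)) v
allBoolVecs-sound (suc n) k all (false ∷ v) = allBoolVecs-sound n (λ v → k (false ∷ v)) (proj₂ (∧-true {allBoolVecs n _} all)) v

-- Walks and spanning trees

module _ {E : Adjacency n} where

  _++ʷ_ : ∀ {u v w} → Walk E u v → Walk E v w → Walk E u w
  here ++ʷ q = q
  step e p ++ʷ q = step e (p ++ʷ q)

  reverseʷ : (∀ u v → E u v ≡ E v u) → ∀ {u v} → Walk E u v → Walk E v u
  reverseʷ E-sym here = here
  reverseʷ E-sym (step {u} {w} e p) = reverseʷ E-sym p ++ʷ step (trans (E-sym w u) e) here

  lengthʷ : ∀ {u v} → Walk E u v → ℕ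
  lengthʷ here = zero
  lengthʷ (step _ p) = suc (lengthʷ p)

  Crossing : (Fin n → Bool) → Set
  Crossing P = ∃₂ λ x y → P x ≡ true × P y ≡ false × E x y ≡ true

  walk-crosses : (P : Fin n → Bool) → ∀ {u v} → Walk E u v → P u ≡ true → P v ≡ false → Crossing P
  walk-crosses P here Pu Pv = ⊥-elim (true≢false (trans (sym Pu) Pv))
  walk-crosses P (step {w = w} e p) Pu Pv with P w in Pw
  ... | true = walk-crosses P p Pw Pv
  ... | false = _ , w , Pu , Pw , e

module _ {A : Set} where

  last : A → List A → A
  last x [] = x
  last x (y ∷ ys) = last y ys

  secondLast : A → A → List A → A
  secondLast x y [] = x
  secondLast x y (z ∷ zs) = secondLast y z zs

  last-∷ʳ : ∀ y zs (x : A) → last y (zs ∷ʳ x) ≡ x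
  last-∷ʳ y [] x = refl
  last-∷ʳ y (z ∷ zs) x = last-∷ʳ z zs x

  secondLast-∷ʳ : ∀ w y zs (x : A) → secondLast w y (zs ∷ʳ x) ≡ last y zs
  secondLast-∷ʳ w y [] x = refl
  secondLast-∷ʳ w y (z ∷ zs) x = secondLast-∷ʳ y z zs x

  All-last : ∀ {P : A → Set} y ys → All P (y ∷ ys) → P (last y ys)
  All-last y [] (Py ∷ _) = Py
  All-last y (z ∷ zs) (_ ∷ Pzs) = All-last z zs Pzs

  Unique-∷ʳ : ∀ (x : A) zs → Unique (x ∷ zs) → Unique (zs ∷ʳ x)
  Unique-∷ʳ x [] _ = [] ∷ []
  Unique-∷ʳ x (z ∷ zs) ((x≢z ∷ x∉zs) ∷ (z∉zs ∷ unique)) =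
    All.++⁺ z∉zs (≢-sym x≢z ∷ []) ∷ Unique-∷ʳ x zs (x∉zs ∷ unique)

  NoBacktracking : List A → Set
  NoBacktracking (x ∷ y ∷ z ∷ zs) = x ≢ z × NoBacktracking (y ∷ z ∷ zs)
  NoBacktracking _ = ⊤

  Unique⇒NoBacktracking : ∀ zs → Unique zs → NoBacktracking zs
  Unique⇒NoBacktracking [] _ = tt
  Unique⇒NoBacktracking (x ∷ []) _ = tt
  Unique⇒NoBacktracking (x ∷ y ∷ []) _ = tt
  Unique⇒NoBacktracking (x ∷ y ∷ z ∷ zs) ((_ ∷ x≢z ∷ _) ∷ unique) = x≢z , Unique⇒NoBacktracking (y ∷ z ∷ zs) unique

leastBelow : (ℕ → Bool) → ℕ → ℕ
leastBelow p zero = zero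
leastBelow p (suc N) = if p zero then zero else suc (leastBelow (λ k → p (suc k)) N)

leastBelow-holds : ∀ (p : ℕ → Bool) N → p N ≡ true → p (leastBelow p N) ≡ true
leastBelow-holds p zero pN = pN
leastBelow-holds p (suc N) pN with p zero in p0
... | true = p0
... | false = leastBelow-holds (λ k → p (suc k)) N pN

leastBelow-least : ∀ (p : ℕ → Bool) N k → p k ≡ true → leastBelow p N ≤ k
leastBelow-least p zero k pk = z≤n
leastBelow-least p (suc N) k pk with p zero in p0
... | true = z≤n
leastBelow-least p (suc N) zero pk | false = ⊥-elim (true≢false (trans (sym pk) p0))
leastBelow-least p (suc N) (suc k) pk | false = s≤s (leastBelow-least (λ j → p (suc j)) N k pk)

module BreadthFirst {m : ℕ} (G : Graph (suc m)) (connected-G : Connected G) (root : Fin (suc m)) where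

  private
    V : Set
    V = Fin (suc m)

  reached : ℕ → V → Bool
  reached zero u = u == root
  reached (suc k) u = reached k u ∨ does (any? λ v → (reached k v ∧ Adj G v u) Bool.≟ true)

  layerNeighbour? : ∀ k u v → Dec ((reached k v ∧ Adj G v u) ≡ true)
  layerNeighbour? k u v = (reached k v ∧ Adj G v u) Bool.≟ true

  reached-walk : ∀ {u} (p : Walk (Adj G) u root) → reached (lengthʷ p) u ≡ true
  reached-walk here = ==-refl root
  reached-walk {u} (step {w = w} e p) =
    ∨-trueʳ (reached (lengthʷ p) u)
      (dec-true (any? (layerNeighbour? (lengthʷ p) u)) (w , cong₂ _∧_ (reached-walk p) (trans (Adj-sym G w u) e)))

  depth : V → ℕ
  depth u = leastBelow (λ k → reached k u) (lengthʷ (connected-G u root))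

  depth-reached : ∀ u → reached (depth u) u ≡ true
  depth-reached u = leastBelow-holds (λ k → reached k u) (lengthʷ (connected-G u root)) (reached-walk (connected-G u root))

  depth-least : ∀ u k → reached k u ≡ true → depth u ≤ k
  depth-least u = leastBelow-least (λ k → reached k u) (lengthʷ (connected-G u root))

  parent : V → V
  parent u = choose (layerNeighbour? (pred (depth u)) u) root

  parent-spec : ∀ {u k} → depth u ≡ suc k → Adj G (parent u) u ≡ true × depth (parent u) ≤ k
  parent-spec {u} {k} d≡1+k = proj₂ below , depth-least (parent u) k (proj₁ below)
    where
    notEarlier : reached k u ≡ false
    notEarlier with reached k u in eq
    ... | false = refl
    ... | true = ⊥-elim (<-irrefl refl (subst (_≤ k) d≡1+k (depth-least u k eq)))
    someNeighbour : ∃ λ v → (reached k v ∧ Adj G v u) ≡ true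
    someNeighbour with ∨-true (subst (λ j → reached j u ≡ true) d≡1+k (depth-reached u))
    ... | inj₁ earlier = ⊥-elim (true≢false (trans (sym earlier) notEarlier))
    ... | inj₂ found = dec-true⁻¹ (any? (layerNeighbour? k u)) found
    below : reached k (parent u) ≡ true × Adj G (parent u) u ≡ true
    below = ∧-true (subst (λ j → (reached j (parent u) ∧ Adj G (parent u) u) ≡ true) (cong pred d≡1+k)
              (choose-spec (layerNeighbour? (pred (depth u)) u) root
                (subst (λ j → ∃ λ v → (reached j v ∧ Adj G v u) ≡ true) (cong pred (sym d≡1+k)) someNeighbour)))

  ParentOf : V → V → Set
  ParentOf a b = parent b ≡ a × depth a < depth b

  private
    zero-or-suc : ∀ d → d ≡ 0 ⊎ ∃ λ k → d ≡ suc k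
    zero-or-suc zero = inj₁ refl
    zero-or-suc (suc k) = inj₂ (k , refl)

  parentOf-adj : ∀ {a b} → ParentOf a b → Adj G a b ≡ true
  parentOf-adj {b = b} (refl , a<b) with zero-or-suc (depth b)
  ... | inj₁ d≡0 = ⊥-elim (n≮0 (subst (depth (parent b) <_) d≡0 a<b))
  ... | inj₂ (k , d≡1+k) = proj₁ (parent-spec d≡1+k)

  parentOf-parent : ∀ {u} → (u == root) ≡ false → ParentOf (parent u) u
  parentOf-parent {u} notRoot with zero-or-suc (depth u)
  ... | inj₁ d≡0 = ⊥-elim (true≢false (trans (sym (subst (λ k → reached k u ≡ true) d≡0 (depth-reached u))) notRoot))
  ... | inj₂ (k , d≡1+k) = refl , subst (depth (parent u) <_) (sym d≡1+k) (s≤s (proj₂ (parent-spec d≡1+k)))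

  childEdge : V → V → Bool
  childEdge u v = not (u == root) ∧ (parent u == v)

  childEdge-parentOf : ∀ {u v} → childEdge u v ≡ true → ParentOf v u
  childEdge-parentOf {u} {v} e with u == root in isRoot
  ... | false = subst (λ w → ParentOf w u) (==⇒≡ {x = parent u} e) (parentOf-parent isRoot)

  treeEdge : V → V → Bool
  treeEdge u v = childEdge u v ∨ childEdge v u

  treeEdge-sym : ∀ u v → treeEdge u v ≡ treeEdge v u
  treeEdge-sym u v = ∨-comm (childEdge u v) (childEdge v u)

  treeEdge-oriented : ∀ {u v} → treeEdge u v ≡ true → ParentOf v u ⊎ ParentOf u v
  treeEdge-oriented {u} {v} e with ∨-true {childEdge u v} e
  ... | inj₁ toParent = inj₁ (childEdge-parentOf toParent)
  ... | inj₂ toChild = inj₂ (childEdge-parentOf toChild)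

  treeEdge-adj : ∀ u v → treeEdge u v ≡ true → Adj G u v ≡ true
  treeEdge-adj u v e with treeEdge-oriented e
  ... | inj₁ v-parent = trans (Adj-sym G u v) (parentOf-adj v-parent)
  ... | inj₂ u-parent = parentOf-adj u-parent

  walkToRoot : ∀ f u → depth u < f → Walk treeEdge u root
  walkToRoot (suc f) u d<1+f with u == root in isRoot
  ... | true = subst (λ x → Walk treeEdge x root) (sym (==⇒≡ isRoot)) here
  ... | false = step (∨-trueˡ (cong₂ _∧_ (cong not isRoot) (==-refl (parent u))))
                     (walkToRoot f (parent u) (<-≤-trans (proj₂ (parentOf-parent isRoot)) (s≤s⁻¹ d<1+f)))

  treeEdge-connected : ∀ u v → Walk treeEdge u v
  treeEdge-connected u v = walkToRoot _ u (n<1+n _) ++ʷ reverseʷ treeEdge-sym (walkToRoot _ v (n<1+n _))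

  TreePath : List V → Set
  TreePath = Linked (λ a b → treeEdge a b ≡ true)

  -- A vertex has a single parent, so after a step away from the root a path without backtracking never turns back.
  awayFromRoot : ∀ a b zs → TreePath (a ∷ b ∷ zs) → NoBacktracking (a ∷ b ∷ zs) → ParentOf a b →
                 depth a < depth (last b zs) × parent (last b zs) ≡ secondLast a b zs
  awayFromRoot a b [] _ _ (b↦a , a<b) = a<b , b↦a
  awayFromRoot a b (c ∷ zs) (_ ∷ path) (a≢c , noBack) (b↦a , a<b) with treeEdge-oriented (Linked.head path)
  ... | inj₁ (b↦c , _) = ⊥-elim (a≢c (trans (sym b↦a) b↦c))
  ... | inj₂ b-parent with awayFromRoot b c zs path noBack b-parent
  ...   | b<last , end = <-trans a<b b<last , end

  towardsRoot : ∀ a b zs → TreePath (a ∷ b ∷ zs) → NoBacktracking (a ∷ b ∷ zs) → ParentOf b a →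
                depth (last b zs) < depth a ⊎ parent (last b zs) ≡ secondLast a b zs
  towardsRoot a b [] _ _ (_ , b<a) = inj₁ b<a
  towardsRoot a b (c ∷ zs) (_ ∷ path) (_ , noBack) (_ , b<a) with treeEdge-oriented (Linked.head path)
  ... | inj₂ b-parent = inj₂ (proj₂ (awayFromRoot b c zs path noBack b-parent))
  ... | inj₁ c-parent with towardsRoot b c zs path noBack c-parent
  ...   | inj₁ last<b = inj₁ (<-trans last<b b<a)
  ...   | inj₂ end = inj₂ end

  treeEdge-acyclic : HasCycle treeEdge → ⊥
  treeEdge-acyclic (x , [] , _ , () , _)
  treeEdge-acyclic (x , _ ∷ [] , _ , s≤s () , _)
  treeEdge-acyclic (x , x₁ ∷ x₂ ∷ ys , unique@((_ ∷ x≢x₂ ∷ _) ∷ (x₁∉ ∷ _)) , _ , cycle) =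
    closes (treeEdge-oriented (Linked.head cycle))
    where
    noBack : NoBacktracking (x ∷ x₁ ∷ x₂ ∷ ys ∷ʳ x)
    noBack = x≢x₂ , Unique⇒NoBacktracking _ (Unique-∷ʳ x (x₁ ∷ x₂ ∷ ys) unique)
    returns : last x₁ (x₂ ∷ ys ∷ʳ x) ≡ x
    returns = last-∷ʳ x₁ (x₂ ∷ ys) x
    closes : ParentOf x₁ x ⊎ ParentOf x x₁ → ⊥
    closes (inj₂ x-parent) =
      <-irrefl refl (subst (depth x <_) (cong depth returns) (proj₁ (awayFromRoot x x₁ _ cycle noBack x-parent)))
    closes (inj₁ (x↦x₁ , x₁<x)) with towardsRoot x x₁ _ cycle noBack (x↦x₁ , x₁<x)
    ... | inj₁ x<x = <-irrefl refl (subst (_< depth x) (cong depth returns) x<x)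
    ... | inj₂ end = All-last x₂ ys x₁∉
          (trans (sym x↦x₁) (trans (subst (λ z → parent z ≡ secondLast x x₁ (x₂ ∷ ys ∷ʳ x)) returns end)
                                   (secondLast-∷ʳ x x₁ (x₂ ∷ ys) x)))

  spanningTree : Tree G
  spanningTree = record
    { inV = λ _ → true
    ; inE = treeEdge
    ; E-sym = treeEdge-sym
    ; E-sub = treeEdge-adj
    ; E-ends = λ _ _ _ → refl
    ; connected = λ u v _ _ → treeEdge-connected u v
    ; acyclic = treeEdge-acyclic
    }

-- Two S-trees meeting only in S

record TwoPacking (G : Graph n) (S : Triple n) : Set where
  field
    X Y : Tree G
    X-spans : ∀ v → v ∈S S → inV X v ≡ true
    Y-spans : ∀ v → v ∈S S → inV Y v ≡ true
    X-Y-disjoint : ∀ u v → inE X u v ≡ true → inE Y u v ≡ false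
    Y-X-disjoint : ∀ u v → inE Y u v ≡ true → inE X u v ≡ false
    X∩Y⊆S : ∀ v → inV X v ≡ true → inV Y v ≡ true → v ∈S S
open TwoPacking

swap : ∀ {G : Graph n} {S} → TwoPacking G S → TwoPacking G S
swap P = record
  { X = Y P ; Y = X P ; X-spans = Y-spans P ; Y-spans = X-spans P
  ; X-Y-disjoint = Y-X-disjoint P ; Y-X-disjoint = X-Y-disjoint P
  ; X∩Y⊆S = λ v inY inX → X∩Y⊆S P v inX inY }

packing⇒twoPacking : ∀ {G : Graph n} {S} {ℓ} → Packing G S (suc (suc ℓ)) → TwoPacking G S
packing⇒twoPacking (T , spans , edge-disjoint , vertex-disjoint) = record
  { X = T 0F ; Y = T 1F
  ; X-spans = spans 0F ; Y-spans = spans 1F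
  ; X-Y-disjoint = edge-disjoint 0F 1F (λ ())
  ; Y-X-disjoint = edge-disjoint 1F 0F (λ ())
  ; X∩Y⊆S = vertex-disjoint 0F 1F (λ ()) }

isKappa3-one : ∀ {m} (G : Graph (suc m)) → Connected G → (Σ (Triple (suc m)) λ S → ¬ TwoPacking G S) → IsKappa3 G 1
isKappa3-one G connected-G (S , ¬twoPacking) = (S , packing₁ S , atMostOne) , λ S′ _ (_ , maximal) → maximal 1 (packing₁ S′)
  where
  open BreadthFirst G connected-G zero using (spanningTree)
  packing₁ : ∀ S → Packing G S 1
  packing₁ S = (λ _ → spanningTree) , (λ _ _ _ → refl)
             , (λ { 0F 0F 0≢0 → ⊥-elim (0≢0 refl) }) , (λ { 0F 0F 0≢0 → ⊥-elim (0≢0 refl) })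
  atMostOne : ∀ ℓ → Packing G S ℓ → ℓ ≤ 1
  atMostOne zero _ = z≤n
  atMostOne (suc zero) _ = s≤s z≤n
  atMostOne (suc (suc ℓ)) P = ⊥-elim (¬twoPacking (packing⇒twoPacking P))

NeighboursWithin : Adjacency n → Fin n → Fin n → Fin n → Set
NeighboursWithin E s p q = ∀ y → E s y ≡ true → y ≡ p ⊎ y ≡ q

LeavesOnlyVia : Adjacency n → (Fin n → Bool) → Fin n → Fin n → Fin n → Fin n → Set
LeavesOnlyVia E P x₁ y₁ x₂ y₂ =
  ∀ x y → P x ≡ true → P y ≡ false → E x y ≡ true → (x ≡ x₁ × y ≡ y₁) ⊎ (x ≡ x₂ × y ≡ y₂)

Closed : Adjacency n → (Fin n → Bool) → Set
Closed E P = ∀ x y → P x ≡ true → P y ≡ false → E x y ≡ false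

module _ {G : Graph n} where

  inE-flip : (T : Tree G) → ∀ {u v} → inE T u v ≡ true → inE T v u ≡ true
  inE-flip T {u} {v} e = trans (E-sym T v u) e

  inE⇒inVʳ : (T : Tree G) → ∀ {u v} → inE T u v ≡ true → inV T v ≡ true
  inE⇒inVʳ T e = E-ends T _ _ (inE-flip T e)

  tree-leavesVia : ∀ {P x₁ y₁ x₂ y₂ u v} (T : Tree G) → LeavesOnlyVia (Adj G) P x₁ y₁ x₂ y₂ →
                   inV T u ≡ true → inV T v ≡ true → P u ≡ true → P v ≡ false →
                   inE T x₁ y₁ ≡ true ⊎ inE T x₂ y₂ ≡ true
  tree-leavesVia {P} T leaves inU inV Pu Pv with walk-crosses P (connected T _ _ inU inV) Pu Pv
  ... | x , y , Px , Py , e with leaves x y Px Py (E-sub T x y e)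
  ...   | inj₁ (refl , refl) = inj₁ e
  ...   | inj₂ (refl , refl) = inj₂ e

  closed⇒¬connected : ∀ (P : Fin n → Bool) {u w} → P u ≡ true → P w ≡ false → Closed (Adj G) P → ¬ Connected G
  closed⇒¬connected P Pu Pw closed connected-G with walk-crosses P (connected-G _ _) Pu Pw
  ... | x , y , Px , Py , e = true≢false (trans (sym e) (closed x y Px Py))

  pair-leavesOnlyVia : ∀ {v x y z} → NeighboursWithin (Adj G) v x y → NeighboursWithin (Adj G) x v z →
                       LeavesOnlyVia (Adj G) (λ q → (q == v) ∨ (q == x)) v y x z
  pair-leavesOnlyVia {v} {x} N[v] N[x] p q p∈ q∉ e with ∨-true {p == v} p∈
  ... | inj₁ p==v with ==⇒≡ {x = p} p==v
  ...   | refl with N[v] q e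
  ...     | inj₁ refl = ⊥-elim (true≢false (trans (sym (∨-trueʳ (x == v) (==-refl x))) q∉))
  ...     | inj₂ refl = inj₁ (refl , refl)
  pair-leavesOnlyVia {v} {x} N[v] N[x] p q p∈ q∉ e | inj₂ p==x with ==⇒≡ {x = p} p==x
  ...   | refl with N[x] q e
  ...     | inj₁ refl = ⊥-elim (true≢false (trans (sym (∨-trueˡ (==-refl v))) q∉))
  ...     | inj₂ refl = inj₂ (refl , refl)

module _ {G : Graph n} {S : Triple n} where

  tree-edgeAt : (T : Tree G) → (∀ v → v ∈S S → inV T v ≡ true) → ∀ {v} → v ∈S S → ∃ λ y → inE T v y ≡ true
  tree-edgeAt T spans {v} v∈S with other v∈S
    where
    other : v ∈S S → ∃ λ w → w ∈S S × w ≢ v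
    other (inj₁ refl) = b S , inj₂ (inj₁ refl) , ≢-sym (a≢b S)
    other (inj₂ (inj₁ refl)) = a S , inj₁ refl , a≢b S
    other (inj₂ (inj₂ refl)) = a S , inj₁ refl , a≢c S
  ... | w , w∈S , w≢v
    with walk-crosses (_== v) (connected T v w (spans v v∈S) (spans w w∈S)) (==-refl v) (≢⇒==-false w≢v)
  ...   | x , y , x==v , _ , e with ==⇒≡ {x = x} x==v
  ...     | refl = y , e

  ¬sharedEdge : (P : TwoPacking G S) → ∀ {u v} → inE (X P) u v ≡ true → inE (Y P) u v ≡ true → ⊥
  ¬sharedEdge P {u} {v} inX inY = true≢false (trans (sym inY) (X-Y-disjoint P u v inX))

  ¬sharedVertex : (P : TwoPacking G S) → ∀ {v} → inV (X P) v ≡ true → inV (Y P) v ≡ true → ¬ v ∈S S → ⊥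
  ¬sharedVertex P inX inY v∉S = v∉S (X∩Y⊆S P _ inX inY)

  twoPacking-splitsAt : (P : TwoPacking G S) → ∀ {s p q} → s ∈S S → NeighboursWithin (Adj G) s p q →
                        (inE (X P) s p ≡ true × inE (Y P) s q ≡ true) ⊎ (inE (X P) s q ≡ true × inE (Y P) s p ≡ true)
  twoPacking-splitsAt P s∈S N[s] with tree-edgeAt (X P) (X-spans P) s∈S | tree-edgeAt (Y P) (Y-spans P) s∈S
  ... | y₁ , inX | y₂ , inY with N[s] y₁ (E-sub (X P) _ y₁ inX) | N[s] y₂ (E-sub (Y P) _ y₂ inY)
  ...   | inj₁ refl | inj₁ refl = ⊥-elim (¬sharedEdge P inX inY)
  ...   | inj₂ refl | inj₂ refl = ⊥-elim (¬sharedEdge P inX inY)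
  ...   | inj₁ refl | inj₂ refl = inj₁ (inX , inY)
  ...   | inj₂ refl | inj₁ refl = inj₂ (inX , inY)

  ¬twoPacking-pendant : ∀ {s t} → s ∈S S → NeighboursWithin (Adj G) s t t → ¬ TwoPacking G S
  ¬twoPacking-pendant s∈S N[s] P with twoPacking-splitsAt P s∈S N[s]
  ... | inj₁ (inX , inY) = ¬sharedEdge P inX inY
  ... | inj₂ (inX , inY) = ¬sharedEdge P inX inY

  -- Each tree leaves {v, x} towards w through v–y or x–z; one tree using each exit then shares an edge at v or x.
  ¬twoPacking-adjacentPair : ∀ {v x y z w} → v ∈S S → x ∈S S → w ∈S S → w ≢ v → w ≢ x →
                             NeighboursWithin (Adj G) v x y → NeighboursWithin (Adj G) x v z → ¬ TwoPacking G S
  ¬twoPacking-adjacentPair {v} {x} {y} {z} {w} v∈S x∈S w∈S w≢v w≢x N[v] N[x] P =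
    refute (exit (X P) (X-spans P)) (exit (Y P) (Y-spans P))
    where
    exit : (T : Tree G) → (∀ q → q ∈S S → inV T q ≡ true) → inE T v y ≡ true ⊎ inE T x z ≡ true
    exit T spans = tree-leavesVia T (pair-leavesOnlyVia {G = G} N[v] N[x]) (spans v v∈S) (spans w w∈S)
                     (∨-trueˡ (==-refl v)) (∨-false (≢⇒==-false w≢v) (≢⇒==-false w≢x))
    core : (P : TwoPacking G S) → inE (X P) v y ≡ true → inE (Y P) x z ≡ true → ⊥
    core P Xvy Yxz with twoPacking-splitsAt P v∈S N[v]
    ... | inj₁ (_ , Yvy) = ¬sharedEdge P Xvy Yvy
    ... | inj₂ (_ , Yvx) with twoPacking-splitsAt P x∈S N[x]
    ...   | inj₁ (Xxv , _) = ¬sharedEdge P Xxv (inE-flip (Y P) Yvx)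
    ...   | inj₂ (Xxz , _) = ¬sharedEdge P Xxz Yxz
    refute : inE (X P) v y ≡ true ⊎ inE (X P) x z ≡ true → inE (Y P) v y ≡ true ⊎ inE (Y P) x z ≡ true → ⊥
    refute (inj₁ Xvy) (inj₁ Yvy) = ¬sharedEdge P Xvy Yvy
    refute (inj₂ Xxz) (inj₂ Yxz) = ¬sharedEdge P Xxz Yxz
    refute (inj₁ Xvy) (inj₂ Yxz) = core P Xvy Yxz
    refute (inj₂ Xxz) (inj₁ Yvy) = core (swap P) Yvy Xxz

  -- If X leaves s₁ towards p and Y towards q, then X must reach s₂ from r and Y must reach s₃ from r.
  ¬twoPacking-triangle : ∀ {s₁ s₂ s₃ p q r} → s₁ ∈S S → s₂ ∈S S → s₃ ∈S S →
                         ¬ p ∈S S → ¬ q ∈S S → ¬ r ∈S S →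
                         NeighboursWithin (Adj G) s₁ p q → NeighboursWithin (Adj G) s₂ q r →
                         NeighboursWithin (Adj G) s₃ p r → ¬ TwoPacking G S
  ¬twoPacking-triangle {s₁} {s₂} {s₃} {p} {q} {r} s₁∈S s₂∈S s₃∈S p∉S q∉S r∉S N[s₁] N[s₂] N[s₃] P =
    refute (twoPacking-splitsAt P s₁∈S N[s₁])
    where
    core : (P : TwoPacking G S) → inE (X P) s₁ p ≡ true → inE (Y P) s₁ q ≡ true → ⊥
    core P Xs₁p Ys₁q with twoPacking-splitsAt P s₂∈S N[s₂] | twoPacking-splitsAt P s₃∈S N[s₃]
    ... | inj₁ (Xs₂q , _) | _ = ¬sharedVertex P (inE⇒inVʳ (X P) Xs₂q) (inE⇒inVʳ (Y P) Ys₁q) q∉S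
    ... | inj₂ _ | inj₂ (_ , Ys₃p) = ¬sharedVertex P (inE⇒inVʳ (X P) Xs₁p) (inE⇒inVʳ (Y P) Ys₃p) p∉S
    ... | inj₂ (Xs₂r , _) | inj₁ (_ , Ys₃r) = ¬sharedVertex P (inE⇒inVʳ (X P) Xs₂r) (inE⇒inVʳ (Y P) Ys₃r) r∉S
    refute : (inE (X P) s₁ p ≡ true × inE (Y P) s₁ q ≡ true) ⊎ (inE (X P) s₁ q ≡ true × inE (Y P) s₁ p ≡ true) → ⊥
    refute (inj₁ (Xs₁p , Ys₁q)) = core P Xs₁p Ys₁q
    refute (inj₂ (Xs₁q , Ys₁p)) = core (swap P) Ys₁p Xs₁q

  -- If X leaves s towards b and Y towards d, then Y must cross out of A through a–a′ and X out of B through c–c′;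
  -- the two crossings share an edge or a vertex outside S.
  ¬twoPacking-cut : ∀ {s b d a a′ c c′} (A B : Fin n → Bool) → s ∈S S → b ∈S S → d ∈S S →
                    NeighboursWithin (Adj G) s b d →
                    A b ≡ true → A d ≡ false → LeavesOnlyVia (Adj G) A b s a a′ →
                    B d ≡ true → B b ≡ false → LeavesOnlyVia (Adj G) B d s c c′ →
                    (a′ ≡ c × c′ ≡ a) ⊎ (a′ ≡ c′ × ¬ a′ ∈S S) → ¬ TwoPacking G S
  ¬twoPacking-cut {s} {b} {d} {a} {a′} {c} {c′} A B s∈S b∈S d∈S N[s] Ab Ad leavesA Bd Bb leavesB route P =
    refute (twoPacking-splitsAt P s∈S N[s])
    where
    core : (P : TwoPacking G S) → inE (X P) s b ≡ true → inE (Y P) s d ≡ true → ⊥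
    core P Xsb Ysd
      with tree-leavesVia (Y P) leavesA (Y-spans P b b∈S) (Y-spans P d d∈S) Ab Ad
         | tree-leavesVia (X P) leavesB (X-spans P d d∈S) (X-spans P b b∈S) Bd Bb
    ... | inj₁ Ybs | _ = ¬sharedEdge P Xsb (inE-flip (Y P) Ybs)
    ... | inj₂ _ | inj₁ Xds = ¬sharedEdge P (inE-flip (X P) Xds) Ysd
    ... | inj₂ Yaa′ | inj₂ Xcc′ = meet route
      where
      meet : (a′ ≡ c × c′ ≡ a) ⊎ (a′ ≡ c′ × ¬ a′ ∈S S) → ⊥
      meet (inj₁ (a′≡c , c′≡a)) =
        ¬sharedEdge P (inE-flip (X P) (subst₂ (λ u w → inE (X P) u w ≡ true) (sym a′≡c) c′≡a Xcc′)) Yaa′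
      meet (inj₂ (a′≡c′ , a′∉S)) =
        ¬sharedVertex P (subst (λ u → inV (X P) u ≡ true) (sym a′≡c′) (inE⇒inVʳ (X P) Xcc′))
                        (inE⇒inVʳ (Y P) Yaa′) a′∉S
    refute : (inE (X P) s b ≡ true × inE (Y P) s d ≡ true) ⊎ (inE (X P) s d ≡ true × inE (Y P) s b ≡ true) → ⊥
    refute (inj₁ (Xsb , Ysd)) = core P Xsb Ysd
    refute (inj₂ (Xsd , Ysb)) = core (swap P) Ysb Xsd

-- Degree counting

indicator : Bool → ℕ
indicator true = 1
indicator false = 0

sumᴸ-filter : ∀ {A : Set} {P : A → Set} (P? : ∀ x → Dec (P x)) xs →
              length (filter P? xs) ≡ sumᴸ (map (λ x → indicator (does (P? x))) xs)
sumᴸ-filter P? [] = refl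
sumᴸ-filter P? (x ∷ xs) with does (P? x)
... | true = cong suc (sumᴸ-filter P? xs)
... | false = sumᴸ-filter P? xs

sumᴸ-cartesianProduct : ∀ {A B : Set} (f : A × B → ℕ) xs ys →
                        sumᴸ (map f (cartesianProduct xs ys)) ≡ sumᴸ (map (λ x → sumᴸ (map (λ y → f (x , y)) ys)) xs)
sumᴸ-cartesianProduct f [] ys = refl
sumᴸ-cartesianProduct f (x ∷ xs) ys = begin
  sumᴸ (map f (map (x ,_) ys ++ cartesianProduct xs ys))
    ≡⟨ cong sumᴸ (map-++ f (map (x ,_) ys) (cartesianProduct xs ys)) ⟩
  sumᴸ (map f (map (x ,_) ys) ++ map f (cartesianProduct xs ys))
    ≡⟨ sumᴸ-++ (map f (map (x ,_) ys)) (map f (cartesianProduct xs ys)) ⟩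
  sumᴸ (map f (map (x ,_) ys)) + sumᴸ (map f (cartesianProduct xs ys))
    ≡⟨ cong₂ _+_ (cong sumᴸ (sym (map-∘ ys))) (sumᴸ-cartesianProduct f xs ys) ⟩
  sumᴸ (map (λ y → f (x , y)) ys) + sumᴸ (map (λ x → sumᴸ (map (λ y → f (x , y)) ys)) xs) ∎
  where open ≡-Reasoning

sumᴸ-tabulate : ∀ {A : Set} {n} (g : A → ℕ) (h : Fin n → A) → sumᴸ (map g (tabulate h)) ≡ ∑[ i < n ] g (h i)
sumᴸ-tabulate {n = zero} g h = refl
sumᴸ-tabulate {n = suc n} g h = cong (g (h zero) +_) (sumᴸ-tabulate g (λ i → h (suc i)))

∑-mono-≤ : ∀ {n} {f g : Fin n → ℕ} → (∀ i → f i ≤ g i) → ∑[ i < n ] f i ≤ ∑[ i < n ] g i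
∑-mono-≤ {zero} _ = z≤n
∑-mono-≤ {suc n} f≤g = +-mono-≤ (f≤g zero) (∑-mono-≤ (λ i → f≤g (suc i)))

∑-≤-tight : ∀ {n} {f g : Fin n → ℕ} → (∀ i → f i ≤ g i) → ∑[ i < n ] g i ≤ ∑[ i < n ] f i →
            ∀ i → f i ≡ g i
∑-≤-tight {suc n} {f} {g} f≤g ∑g≤∑f = pointwise
  where
  tail≤ : ∑[ i < n ] f (suc i) ≤ ∑[ i < n ] g (suc i)
  tail≤ = ∑-mono-≤ (λ i → f≤g (suc i))
  f₀≡g₀ : f zero ≡ g zero
  f₀≡g₀ = ≤-antisym (f≤g zero) (+-cancelʳ-≤ _ (g zero) (f zero) (≤-trans ∑g≤∑f (+-monoʳ-≤ (f zero) tail≤)))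
  tail≥ : ∑[ i < n ] g (suc i) ≤ ∑[ i < n ] f (suc i)
  tail≥ = +-cancelˡ-≤ (f zero) _ _ (subst (λ x → x + _ ≤ f zero + _) (sym f₀≡g₀) ∑g≤∑f)
  pointwise : ∀ i → f i ≡ g i
  pointwise zero = f₀≡g₀
  pointwise (suc i) = ∑-≤-tight (λ j → f≤g (suc j)) tail≥ i

∑-splitAt : ∀ m {n} (f : Fin (m + n) → ℕ) → ∑[ i < m + n ] f i ≡ ∑[ i < m ] f (i ↑ˡ n) + ∑[ j < n ] f (m ↑ʳ j)
∑-splitAt zero f = refl
∑-splitAt (suc m) f = trans (cong (f zero +_) (∑-splitAt m (λ i → f (suc i)))) (sym (+-assoc (f zero) _ _))

module Degrees (G : Graph n) where

  deg : Fin n → ℕ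
  deg v = ∑[ u < n ] indicator (Adj G v u)

  private
    forward : Fin n → Fin n → ℕ
    forward i j = indicator (does ((toℕ i <? toℕ j) ×-dec T? (Adj G i j)))

    numEdges≡∑forward : numEdges G ≡ ∑[ i < n ] ∑[ j < n ] forward i j
    numEdges≡∑forward = begin
      numEdges G
        ≡⟨ sumᴸ-filter (λ p → (toℕ (proj₁ p) <? toℕ (proj₂ p)) ×-dec T? (Adj G (proj₁ p) (proj₂ p)))
                       (cartesianProduct (allFin n) (allFin n)) ⟩
      sumᴸ (map (λ p → forward (proj₁ p) (proj₂ p)) (cartesianProduct (allFin n) (allFin n)))
        ≡⟨ sumᴸ-cartesianProduct (λ p → forward (proj₁ p) (proj₂ p)) (allFin n) (allFin n) ⟩
      sumᴸ (map (λ i → sumᴸ (map (forward i) (allFin n))) (allFin n))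
        ≡⟨ sumᴸ-tabulate (λ i → sumᴸ (map (forward i) (allFin n))) (λ i → i) ⟩
      ∑[ i < n ] sumᴸ (map (forward i) (allFin n))
        ≡⟨ sum-cong-≗ (λ i → sumᴸ-tabulate (forward i) (λ j → j)) ⟩
      ∑[ i < n ] ∑[ j < n ] forward i j ∎
      where open ≡-Reasoning

    -- each edge is counted once, from its endpoint of smaller index
    indicator-split : ∀ i j → indicator (Adj G i j) ≡ forward i j + forward j i
    indicator-split i j with toℕ i <ᵇ toℕ j in i<ᵇj | toℕ j <ᵇ toℕ i in j<ᵇi
    ... | true | true = ⊥-elim (<-asym (<ᵇ⇒< (toℕ i) (toℕ j) (T-true i<ᵇj)) (<ᵇ⇒< (toℕ j) (toℕ i) (T-true j<ᵇi)))
    ... | true | false = sym (+-identityʳ _)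
    ... | false | true = cong indicator (Adj-sym G i j)
    ... | false | false = subst (λ k → indicator (Adj G i k) ≡ 0) i≡j (cong indicator (Adj-irrefl G i))
      where
      ≮ᵇ : ∀ {x y} → (x <ᵇ y) ≡ false → ¬ x < y
      ≮ᵇ x≮y x<y = subst T x≮y (<⇒<ᵇ x<y)
      i≡j : i ≡ j
      i≡j = toℕ-injective (≤-antisym (≮⇒≥ (≮ᵇ {toℕ j} j<ᵇi)) (≮⇒≥ (≮ᵇ {toℕ i} i<ᵇj)))

  handshake : ∑[ v < n ] deg v ≡ 2 * numEdges G
  handshake = begin
    ∑[ i < n ] ∑[ j < n ] indicator (Adj G i j)
      ≡⟨ sum-cong-≗ (λ i → sum-cong-≗ (indicator-split i)) ⟩
    ∑[ i < n ] ∑[ j < n ] (forward i j + forward j i)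
      ≡⟨ sum-cong-≗ (λ i → ∑-distrib-+ (forward i) (λ j → forward j i)) ⟩
    ∑[ i < n ] (∑[ j < n ] forward i j + ∑[ j < n ] forward j i)
      ≡⟨ ∑-distrib-+ (λ i → ∑[ j < n ] forward i j) (λ i → ∑[ j < n ] forward j i) ⟩
    ∑[ i < n ] ∑[ j < n ] forward i j + ∑[ i < n ] ∑[ j < n ] forward j i
      ≡⟨ cong (∑[ i < n ] ∑[ j < n ] forward i j +_) (∑-comm (λ i j → forward j i)) ⟩
    ∑[ i < n ] ∑[ j < n ] forward i j + ∑[ j < n ] ∑[ i < n ] forward j i
      ≡⟨ cong (λ e → e + e) (sym numEdges≡∑forward) ⟩
    numEdges G + numEdges G
      ≡⟨ cong (numEdges G +_) (sym (+-identityʳ (numEdges G))) ⟩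
    2 * numEdges G ∎
    where open ≡-Reasoning

module Neighbours (G : Graph n) where
  open Degrees G

  neighbours : Fin n → List (Fin n)
  neighbours v = filter (λ u → T? (Adj G v u)) (allFin n)

  length-neighbours : ∀ v → length (neighbours v) ≡ deg v
  length-neighbours v =
    trans (sumᴸ-filter (λ u → T? (Adj G v u)) (allFin n)) (sumᴸ-tabulate (λ u → indicator (Adj G v u)) (λ u → u))

  ∈-neighbours : ∀ {v u} → Adj G v u ≡ true → u ∈ neighbours v
  ∈-neighbours {v} {u} e = ∈-filter⁺ (λ u → T? (Adj G v u)) (∈-allFin u) (T-true e)

  neighbours-adj : ∀ {v u} → u ∈ neighbours v → Adj G v u ≡ true
  neighbours-adj {v} u∈ = T⇒true (proj₂ (∈-filter⁻ (λ u → T? (Adj G v u)) {xs = allFin n} u∈))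

  neighbours-unique : ∀ v → Unique (neighbours v)
  neighbours-unique v = Unique.filter⁺ (λ u → T? (Adj G v u)) {allFin n} (Unique.allFin⁺ n)

  deg≤1-neighbours : ∀ {v t} → deg v ≤ 1 → Adj G v t ≡ true → NeighboursWithin (Adj G) v t t
  deg≤1-neighbours {v} deg≤1 e y e′ = inj₁ (single (neighbours v) (subst (_≤ 1) (sym (length-neighbours v)) deg≤1)
                                                   (∈-neighbours e′) (∈-neighbours e))
    where
    single : ∀ xs → length xs ≤ 1 → ∀ {x y} → x ∈ xs → y ∈ xs → x ≡ y
    single (_ ∷ []) _ (here refl) (here refl) = refl
    single (_ ∷ _ ∷ _) (s≤s ()) _ _

  deg≡2-neighbours : ∀ {v} → deg v ≡ 2 → Σ (Fin n) λ p → Σ (Fin n) λ q →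
                     p ≢ q × Adj G v p ≡ true × Adj G v q ≡ true × NeighboursWithin (Adj G) v p q
  deg≡2-neighbours {v} deg≡2 = pair (neighbours v) (trans (length-neighbours v) deg≡2) (neighbours-unique v) refl
    where
    pair : ∀ xs → length xs ≡ 2 → Unique xs → xs ≡ neighbours v → Σ (Fin n) λ p → Σ (Fin n) λ q →
           p ≢ q × Adj G v p ≡ true × Adj G v q ≡ true × NeighboursWithin (Adj G) v p q
    pair (p ∷ q ∷ []) _ ((p≢q ∷ []) ∷ _) xs≡ =
      p , q , p≢q , neighbours-adj (subst (p ∈_) xs≡ (here refl)) , neighbours-adj (subst (q ∈_) xs≡ (there (here refl))) ,
      λ y e → within (subst (y ∈_) (sym xs≡) (∈-neighbours e))
      where
      within : ∀ {y} → y ∈ p ∷ q ∷ [] → y ≡ p ⊎ y ≡ q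
      within (here y≡p) = inj₁ y≡p
      within (there (here y≡q)) = inj₂ y≡q

2≤≢2⇒3≤ : ∀ {d} → 2 ≤ d → (d ≡ᵇ 2) ≡ false → 3 ≤ d
2≤≢2⇒3≤ {suc zero} (s≤s ()) _
2≤≢2⇒3≤ {suc (suc zero)} _ ()
2≤≢2⇒3≤ {suc (suc (suc d))} _ _ = s≤s (s≤s (s≤s z≤n))

module DegreeTwo (G : Graph n) where
  open Degrees G

  isDeg2 : Fin n → Bool
  isDeg2 v = deg v ≡ᵇ 2

  𝟙deg2 𝟙other : Fin n → ℕ
  𝟙deg2 v = indicator (isDeg2 v)
  𝟙other v = indicator (not (isDeg2 v))

  isDeg2⇒≡2 : ∀ {v} → isDeg2 v ≡ true → deg v ≡ 2
  isDeg2⇒≡2 {v} d≡2 = ≡ᵇ⇒≡ (deg v) 2 (T-true d≡2)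

  ≡2⇒isDeg2 : ∀ {v} → deg v ≡ 2 → isDeg2 v ≡ true
  ≡2⇒isDeg2 {v} d≡2 = T⇒true (≡⇒≡ᵇ (deg v) 2 d≡2)

  ∑3≤2m+∑𝟙deg2 : (∀ v → 2 ≤ deg v) → ∑[ v < n ] 3 ≤ 2 * numEdges G + ∑[ v < n ] 𝟙deg2 v
  ∑3≤2m+∑𝟙deg2 minDeg = begin
    ∑[ v < n ] 3                          ≤⟨ ∑-mono-≤ three≤ ⟩
    ∑[ v < n ] (deg v + 𝟙deg2 v)          ≡⟨ ∑-distrib-+ deg 𝟙deg2 ⟩
    ∑[ v < n ] deg v + ∑[ v < n ] 𝟙deg2 v ≡⟨ cong (_+ ∑[ v < n ] 𝟙deg2 v) handshake ⟩
    2 * numEdges G + ∑[ v < n ] 𝟙deg2 v   ∎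
    where
    open ≤-Reasoning
    three≤ : ∀ v → 3 ≤ deg v + 𝟙deg2 v
    three≤ v with isDeg2 v in d≟2
    ... | true = ≤-reflexive (cong (_+ 1) (sym (isDeg2⇒≡2 d≟2)))
    ... | false = ≤-trans (2≤≢2⇒3≤ (minDeg v) d≟2) (m≤m+n (deg v) 0)

  ∑𝟙deg2*deg : ∑[ v < n ] (𝟙deg2 v * deg v) ≡ 2 * ∑[ v < n ] 𝟙deg2 v
  ∑𝟙deg2*deg = trans (sum-cong-≗ twice) (sym (*-distribˡ-sum 2 𝟙deg2))
    where
    twice : ∀ v → 𝟙deg2 v * deg v ≡ 2 * 𝟙deg2 v
    twice v with isDeg2 v in d≟2
    ... | true = trans (+-identityʳ (deg v)) (isDeg2⇒≡2 d≟2)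
    ... | false = refl

  ∑𝟙deg2*deg+∑𝟙other*deg : ∑[ v < n ] (𝟙deg2 v * deg v) + ∑[ v < n ] (𝟙other v * deg v) ≡ 2 * numEdges G
  ∑𝟙deg2*deg+∑𝟙other*deg = trans (sym (∑-distrib-+ (λ v → 𝟙deg2 v * deg v) (λ v → 𝟙other v * deg v)))
                 (trans (sum-cong-≗ split) handshake)
    where
    split : ∀ v → 𝟙deg2 v * deg v + 𝟙other v * deg v ≡ deg v
    split v with isDeg2 v
    ... | true = trans (+-identityʳ (deg v + 0)) (+-identityʳ (deg v))
    ... | false = +-identityʳ (deg v)

  ∑𝟙deg2*deg≤∑𝟙other*deg : (∀ v w → deg v ≡ 2 → deg w ≡ 2 → Adj G v w ≡ false) →
                           ∑[ v < n ] (𝟙deg2 v * deg v) ≤ ∑[ v < n ] (𝟙other v * deg v)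
  ∑𝟙deg2*deg≤∑𝟙other*deg independent = begin
    ∑[ v < n ] (𝟙deg2 v * deg v)
      ≡⟨ sum-cong-≗ (λ v → *-distribˡ-sum (𝟙deg2 v) (λ u → indicator (Adj G v u))) ⟩
    ∑[ v < n ] ∑[ u < n ] (𝟙deg2 v * indicator (Adj G v u))
      ≤⟨ ∑-mono-≤ (λ v → ∑-mono-≤ (edgeEnd v)) ⟩
    ∑[ v < n ] ∑[ u < n ] (𝟙other u * indicator (Adj G v u))
      ≡⟨ ∑-comm (λ v u → 𝟙other u * indicator (Adj G v u)) ⟩
    ∑[ u < n ] ∑[ v < n ] (𝟙other u * indicator (Adj G v u))
      ≡⟨ sum-cong-≗ (λ u → sym (*-distribˡ-sum (𝟙other u) (λ v → indicator (Adj G v u)))) ⟩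
    ∑[ u < n ] (𝟙other u * ∑[ v < n ] indicator (Adj G v u))
      ≡⟨ sum-cong-≗ (λ u → cong (𝟙other u *_) (sum-cong-≗ (λ v → cong indicator (Adj-sym G v u)))) ⟩
    ∑[ u < n ] (𝟙other u * deg u) ∎
    where
    open ≤-Reasoning
    edgeEnd : ∀ v u → 𝟙deg2 v * indicator (Adj G v u) ≤ 𝟙other u * indicator (Adj G v u)
    edgeEnd v u with isDeg2 v in v≟2
    ... | false = z≤n
    ... | true with Adj G v u in vu
    ...   | false = z≤n
    ...   | true with isDeg2 u in u≟2
    ...     | false = ≤-refl
    ...     | true = ⊥-elim (true≢false (trans (sym vu) (independent v u (isDeg2⇒≡2 v≟2) (isDeg2⇒≡2 u≟2))))

module NineVerticesElevenEdges (G : Graph 9) (edges : numEdges G ≡ 11) where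
  open Degrees G
  open DegreeTwo G

  -- With k vertices of degree two: 3 · 9 ≤ 22 + k, and the 2k edge ends at them are matched by
  -- edge ends at the other vertices, so 2k + 2k ≤ 22.
  module _ (minDeg : ∀ v → 2 ≤ deg v) (independent : ∀ v w → deg v ≡ 2 → deg w ≡ 2 → Adj G v w ≡ false) where

    private
      k ∑other*deg : ℕ
      k = ∑[ v < 9 ] 𝟙deg2 v
      ∑other*deg = ∑[ v < 9 ] (𝟙other v * deg v)

      2k+∑other*deg : 2 * k + ∑other*deg ≡ 22
      2k+∑other*deg = trans (cong (_+ ∑other*deg) (sym ∑𝟙deg2*deg)) (trans ∑𝟙deg2*deg+∑𝟙other*deg (cong (2 *_) edges))

      5≤k : 5 ≤ k
      5≤k = +-cancelˡ-≤ 22 5 k (subst (λ e → 27 ≤ 2 * e + k) edges (∑3≤2m+∑𝟙deg2 minDeg))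

      k≤5 : k ≤ 5
      k≤5 with k ≤? 5
      ... | yes k≤5 = k≤5
      ... | no k≰5 = ⊥-elim (≤⇒≤ᵇ (≤-trans (+-mono-≤ (*-monoʳ-≤ 2 6≤k) (*-monoʳ-≤ 2 6≤k)) 4k≤22))
        where
        6≤k : 6 ≤ k
        6≤k = ≰⇒> k≰5
        4k≤22 : 2 * k + 2 * k ≤ 22
        4k≤22 = subst (2 * k + 2 * k ≤_) 2k+∑other*deg
                  (+-monoʳ-≤ (2 * k) (subst (_≤ ∑other*deg) ∑𝟙deg2*deg (∑𝟙deg2*deg≤∑𝟙other*deg independent)))

    ∑𝟙deg2≡5 : ∑[ v < 9 ] 𝟙deg2 v ≡ 5
    ∑𝟙deg2≡5 = ≤-antisym k≤5 5≤k

    ∑𝟙other≡4 : ∑[ v < 9 ] 𝟙other v ≡ 4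
    ∑𝟙other≡4 = +-cancelˡ-≡ 5 _ 4 (trans (cong (_+ ∑[ v < 9 ] 𝟙other v) (sym ∑𝟙deg2≡5))
                                  (trans (sym (∑-distrib-+ 𝟙deg2 𝟙other)) (sum-cong-≗ one)))
      where
      one : ∀ v → 𝟙deg2 v + 𝟙other v ≡ 1
      one v with isDeg2 v
      ... | true = refl
      ... | false = refl

    other⇒deg≡3 : ∀ v → isDeg2 v ≡ false → deg v ≡ 3
    other⇒deg≡3 v v≢2 = trans (sym (+-identityʳ (deg v)))
                              (sym (subst (λ e → 3 * e ≡ e * deg v) (cong indicator (cong not v≢2)) (tight v)))
      where
      3≤ : ∀ v → 3 * 𝟙other v ≤ 𝟙other v * deg v
      3≤ v with isDeg2 v in v≟2
      ... | true = z≤n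
      ... | false = ≤-trans (2≤≢2⇒3≤ (minDeg v) v≟2) (m≤m+n (deg v) 0)
      ∑other*deg≡12 : ∑other*deg ≡ 12
      ∑other*deg≡12 = +-cancelˡ-≡ 10 _ 12 (subst (λ e → 2 * e + ∑other*deg ≡ 22) ∑𝟙deg2≡5 2k+∑other*deg)
      tight : ∀ v → 3 * 𝟙other v ≡ 𝟙other v * deg v
      tight = ∑-≤-tight 3≤ (≤-reflexive (trans ∑other*deg≡12
                (sym (trans (sym (*-distribˡ-sum 3 𝟙other)) (cong (3 *_) ∑𝟙other≡4)))))


module _ {A : Set} where

  lookup-injective : ∀ {xs : List A} → Unique xs → ∀ {i j} → List.lookup xs i ≡ List.lookup xs j → i ≡ j
  lookup-injective {_ ∷ _} _ {zero} {zero} _ = refl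
  lookup-injective {_ ∷ _} (x∉ ∷ _) {zero} {suc j} eq = ⊥-elim (All.lookup x∉ (∈-lookup j) eq)
  lookup-injective {_ ∷ _} (x∉ ∷ _) {suc i} {zero} eq = ⊥-elim (All.lookup x∉ (∈-lookup i) (sym eq))
  lookup-injective {_ ∷ _} (_ ∷ unique) {suc i} {suc j} eq = cong suc (lookup-injective unique eq)

  module Enumeration {m : ℕ} (xs : List A) (length≡m : length xs ≡ m) where

    at : Fin m → A
    at i = List.lookup xs (cast (sym length≡m) i)

    at-injective : Unique xs → ∀ {i j} → at i ≡ at j → i ≡ j
    at-injective unique {i} {j} eq = begin
      i                                        ≡⟨ sym (cast-involutive length≡m (sym length≡m) i) ⟩
      cast length≡m (cast (sym length≡m) i)    ≡⟨ cong (cast length≡m) (lookup-injective unique eq) ⟩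
      cast length≡m (cast (sym length≡m) j)    ≡⟨ cast-involutive length≡m (sym length≡m) j ⟩
      j                                        ∎
      where open ≡-Reasoning

    at-surjective : ∀ {x} → x ∈ xs → ∃ λ i → at i ≡ x
    at-surjective x∈xs = cast length≡m (Any.index x∈xs) ,
      trans (cong (List.lookup xs) (cast-involutive (sym length≡m) length≡m (Any.index x∈xs))) (sym (lookup-index x∈xs))

    at-All : ∀ {P : A → Set} → All P xs → ∀ i → P (at i)
    at-All all i = All.lookup all (∈-lookup _)

-- Certificates against two S-trees

Distinct : Fin n → Fin n → Fin n → Set
Distinct x y z = x ≢ y × x ≢ z × y ≢ z

Outside : Fin n → Fin n → Fin n → Fin n → Set
Outside t x y z = t ≢ x × t ≢ y × t ≢ z

data Certificate (n : ℕ) : Set where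
  triangle : (s₁ s₂ s₃ p q r : Fin n) → Certificate n
  cut : (s b d a a′ c c′ : Fin n) (A B : Fin n → Bool) → Certificate n
  disconnected : (u w : Fin n) (M : Fin n → Bool) → Certificate n

Valid : Adjacency n → Certificate n → Set
Valid E (triangle s₁ s₂ s₃ p q r) =
  Distinct s₁ s₂ s₃ × NeighboursWithin E s₁ p q × NeighboursWithin E s₂ q r × NeighboursWithin E s₃ p r ×
  Outside p s₁ s₂ s₃ × Outside q s₁ s₂ s₃ × Outside r s₁ s₂ s₃
Valid E (cut s b d a a′ c c′ A B) =
  Distinct s b d × NeighboursWithin E s b d ×
  A b ≡ true × A d ≡ false × LeavesOnlyVia E A b s a a′ ×
  B d ≡ true × B b ≡ false × LeavesOnlyVia E B d s c c′ ×
  ((a′ ≡ c × c′ ≡ a) ⊎ (a′ ≡ c′ × Outside a′ s b d))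
Valid E (disconnected u w M) = M u ≡ true × M w ≡ false × Closed E M

distinct? : (x y z : Fin n) → Dec (Distinct x y z)
distinct? x y z = ¬? (x ≟ y) ×-dec ¬? (x ≟ z) ×-dec ¬? (y ≟ z)

outside? : (t x y z : Fin n) → Dec (Outside t x y z)
outside? t x y z = ¬? (t ≟ x) ×-dec ¬? (t ≟ y) ×-dec ¬? (t ≟ z)

module _ (E : Adjacency n) where

  neighboursWithin? : ∀ s p q → Dec (NeighboursWithin E s p q)
  neighboursWithin? s p q = all? λ y → (E s y Bool.≟ true) →-dec ((y ≟ p) ⊎-dec (y ≟ q))

  leavesOnlyVia? : ∀ P x₁ y₁ x₂ y₂ → Dec (LeavesOnlyVia E P x₁ y₁ x₂ y₂)
  leavesOnlyVia? P x₁ y₁ x₂ y₂ = all? λ x → all? λ y →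
    (P x Bool.≟ true) →-dec (P y Bool.≟ false) →-dec (E x y Bool.≟ true) →-dec
    (((x ≟ x₁) ×-dec (y ≟ y₁)) ⊎-dec ((x ≟ x₂) ×-dec (y ≟ y₂)))

  closed? : ∀ P → Dec (Closed E P)
  closed? P = all? λ x → all? λ y → (P x Bool.≟ true) →-dec (P y Bool.≟ false) →-dec (E x y Bool.≟ false)

  valid? : ∀ c → Dec (Valid E c)
  valid? (triangle s₁ s₂ s₃ p q r) =
    distinct? s₁ s₂ s₃ ×-dec neighboursWithin? s₁ p q ×-dec neighboursWithin? s₂ q r ×-dec neighboursWithin? s₃ p r ×-dec
    outside? p s₁ s₂ s₃ ×-dec outside? q s₁ s₂ s₃ ×-dec outside? r s₁ s₂ s₃
  valid? (cut s b d a a′ c c′ A B) =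
    distinct? s b d ×-dec neighboursWithin? s b d ×-dec
    (A b Bool.≟ true) ×-dec (A d Bool.≟ false) ×-dec leavesOnlyVia? A b s a a′ ×-dec
    (B d Bool.≟ true) ×-dec (B b Bool.≟ false) ×-dec leavesOnlyVia? B d s c c′ ×-dec
    (((a′ ≟ c) ×-dec (c′ ≟ a)) ⊎-dec ((a′ ≟ c′) ×-dec outside? a′ s b d))
  valid? (disconnected u w M) = (M u Bool.≟ true) ×-dec (M w Bool.≟ false) ×-dec closed? M

module Relabelling (G : Graph n) (ρ : Fin n → Fin n)
                   (ρ-injective : ∀ {i j} → ρ i ≡ ρ j → i ≡ j) (ρ-surjective : ∀ x → ∃ λ i → ρ i ≡ x)
                   (E : Adjacency n) (realises : ∀ i j → Adj G (ρ i) (ρ j) ≡ E i j) where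

  σ : Fin n → Fin n
  σ x = choose (λ i → ρ i ≟ x) x

  ρσ : ∀ x → ρ (σ x) ≡ x
  ρσ x = choose-spec (λ i → ρ i ≟ x) x (ρ-surjective x)

  σρ : ∀ i → σ (ρ i) ≡ i
  σρ i = ρ-injective (ρσ (ρ i))

  realises-σ : ∀ {x y} → Adj G x y ≡ true → E (σ x) (σ y) ≡ true
  realises-σ {x} {y} e = trans (sym (realises (σ x) (σ y))) (subst₂ (λ u w → Adj G u w ≡ true) (sym (ρσ x)) (sym (ρσ y)) e)

  pullback : (Fin n → Bool) → Fin n → Bool
  pullback P x = P (σ x)

  pullback-ρ : ∀ P i → pullback P (ρ i) ≡ P i
  pullback-ρ P i = cong P (σρ i)

  from-σ : ∀ {x i} → σ x ≡ i → x ≡ ρ i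
  from-σ {x} σx≡i = trans (sym (ρσ x)) (cong ρ σx≡i)

  neighboursWithin-ρ : ∀ {s p q} → NeighboursWithin E s p q → NeighboursWithin (Adj G) (ρ s) (ρ p) (ρ q)
  neighboursWithin-ρ {s} N y e with N (σ y) (subst (λ t → E t (σ y) ≡ true) (σρ s) (realises-σ e))
  ... | inj₁ σy≡p = inj₁ (from-σ σy≡p)
  ... | inj₂ σy≡q = inj₂ (from-σ σy≡q)

  leavesOnlyVia-ρ : ∀ {P x₁ y₁ x₂ y₂} → LeavesOnlyVia E P x₁ y₁ x₂ y₂ →
                    LeavesOnlyVia (Adj G) (pullback P) (ρ x₁) (ρ y₁) (ρ x₂) (ρ y₂)
  leavesOnlyVia-ρ leaves x y Px Py e with leaves (σ x) (σ y) Px Py (realises-σ e)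
  ... | inj₁ (σx≡x₁ , σy≡y₁) = inj₁ (from-σ σx≡x₁ , from-σ σy≡y₁)
  ... | inj₂ (σx≡x₂ , σy≡y₂) = inj₂ (from-σ σx≡x₂ , from-σ σy≡y₂)

  closed-ρ : ∀ {P} → Closed E P → Closed (Adj G) (pullback P)
  closed-ρ closed x y Px Py =
    subst₂ (λ u w → Adj G u w ≡ false) (ρσ x) (ρσ y) (trans (realises (σ x) (σ y)) (closed (σ x) (σ y) Px Py))

  tripleOf : ∀ {x y z} → Distinct x y z → Triple n
  tripleOf {x} {y} {z} (x≢y , x≢z , y≢z) =
    triple (ρ x) (ρ y) (ρ z) (λ e → x≢y (ρ-injective e)) (λ e → x≢z (ρ-injective e)) (λ e → y≢z (ρ-injective e))

  outside-ρ : ∀ {t x y z} (d : Distinct x y z) → Outside t x y z → ¬ ρ t ∈S tripleOf d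
  outside-ρ _ (t≢x , _ , _) (inj₁ e) = t≢x (ρ-injective e)
  outside-ρ _ (_ , t≢y , _) (inj₂ (inj₁ e)) = t≢y (ρ-injective e)
  outside-ρ _ (_ , _ , t≢z) (inj₂ (inj₂ e)) = t≢z (ρ-injective e)

  certificate-sound : Connected G → (c : Certificate n) → Valid E c → Σ (Triple n) λ S → ¬ TwoPacking G S
  certificate-sound _ (triangle s₁ s₂ s₃ p q r) (d , N₁ , N₂ , N₃ , p∉ , q∉ , r∉) =
    tripleOf d , ¬twoPacking-triangle (inj₁ refl) (inj₂ (inj₁ refl)) (inj₂ (inj₂ refl))
                   (outside-ρ d p∉) (outside-ρ d q∉) (outside-ρ d r∉)
                   (neighboursWithin-ρ N₁) (neighboursWithin-ρ N₂) (neighboursWithin-ρ N₃)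
  certificate-sound _ (cut s b d a a′ c c′ A B) (dist , N , Ab , Ad , leavesA , Bd , Bb , leavesB , route) =
    tripleOf dist , ¬twoPacking-cut (pullback A) (pullback B) (inj₁ refl) (inj₂ (inj₁ refl)) (inj₂ (inj₂ refl))
                      (neighboursWithin-ρ N)
                      (trans (pullback-ρ A b) Ab) (trans (pullback-ρ A d) Ad) (leavesOnlyVia-ρ leavesA)
                      (trans (pullback-ρ B d) Bd) (trans (pullback-ρ B b) Bb) (leavesOnlyVia-ρ leavesB)
                      (route-ρ route)
    where
    route-ρ : (a′ ≡ c × c′ ≡ a) ⊎ (a′ ≡ c′ × Outside a′ s b d) →
              (ρ a′ ≡ ρ c × ρ c′ ≡ ρ a) ⊎ (ρ a′ ≡ ρ c′ × ¬ ρ a′ ∈S tripleOf dist)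
    route-ρ (inj₁ (a′≡c , c′≡a)) = inj₁ (cong ρ a′≡c , cong ρ c′≡a)
    route-ρ (inj₂ (a′≡c′ , a′∉)) = inj₂ (cong ρ a′≡c′ , outside-ρ dist a′∉)
  certificate-sound connected-G (disconnected u w M) (Mu , Mw , closed) =
    ⊥-elim (closed⇒¬connected {G = G} (pullback M) (trans (pullback-ρ M u) Mu) (trans (pullback-ρ M w) Mw)
                              (closed-ρ closed) connected-G)

-- Subdivisions of cubic multigraphs on four vertices

Hub Sub Pair : Set
Hub = Fin 4
Sub = Fin 5
Pair = Fin 6

hub : Hub → Fin 9
hub h = h ↑ˡ 5

sub : Sub → Fin 9
sub k = 4 ↑ʳ k

ends : Pair → Hub × Hub
ends 0F = 0F , 1F
ends 1F = 0F , 2F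
ends 2F = 0F , 3F
ends 3F = 1F , 2F
ends 4F = 1F , 3F
ends 5F = 2F , 3F

-- undefined on the diagonal, where it returns 0F
pairOf : Hub → Hub → Pair
pairOf 0F 1F = 0F
pairOf 0F 2F = 1F
pairOf 0F 3F = 2F
pairOf 1F 2F = 3F
pairOf 1F 3F = 4F
pairOf 2F 3F = 5F
pairOf 1F 0F = 0F
pairOf 2F 0F = 1F
pairOf 3F 0F = 2F
pairOf 2F 1F = 3F
pairOf 3F 1F = 4F
pairOf 3F 2F = 5F
pairOf _ _ = 0F

complement : Pair → Pair
complement 0F = 5F
complement 1F = 4F
complement 2F = 3F
complement 3F = 2F
complement 4F = 1F
complement 5F = 0F

_∈ᵖ_ : Hub → Pair → Bool
h ∈ᵖ p = (h == proj₁ (ends p)) ∨ (h == proj₂ (ends p))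

-- In configAdj c, vertex h ↑ˡ 5 is hub h and vertex 4 ↑ʳ k is subdivision vertex k; direct c marks the pairs
-- of hubs joined by an edge and attach c k is the pair of hubs adjacent to subdivision vertex k.
record Config : Set where
  constructor config
  field
    direct : Vec Bool 6
    attach : Vec Pair 5
open Config using (attach)

hubAdj : Vec Bool 6 → Hub → Hub → Bool
hubAdj d a b = not (a == b) ∧ lookup d (pairOf a b)

adj⊎ : Config → Hub ⊎ Sub → Hub ⊎ Sub → Bool
adj⊎ c (inj₁ a) (inj₁ b) = hubAdj (Config.direct c) a b
adj⊎ c (inj₁ a) (inj₂ k) = a ∈ᵖ lookup (attach c) k
adj⊎ c (inj₂ k) (inj₁ a) = a ∈ᵖ lookup (attach c) k
adj⊎ c (inj₂ _) (inj₂ _) = false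

configAdj : Config → Adjacency 9
configAdj c i j = adj⊎ c (splitAt 4 i) (splitAt 4 j)

∈ᵖ-pairOf : ∀ a b c → a ≢ b → c ∈ᵖ pairOf a b ≡ (c == a) ∨ (c == b)
∈ᵖ-pairOf = dec-true⁻¹ (all? λ a → all? λ b → all? λ c →
                            ¬? (a ≟ b) →-dec ((c ∈ᵖ pairOf a b) Bool.≟ ((c == a) ∨ (c == b)))) refl

ends-pairOf : ∀ a b → a ≢ b → ends (pairOf a b) ≡ (a , b) ⊎ ends (pairOf a b) ≡ (b , a)
ends-pairOf = dec-true⁻¹ (all? λ a → all? λ b →
                              ¬? (a ≟ b) →-dec ((ends (pairOf a b) ≟₂ (a , b)) ⊎-dec (ends (pairOf a b) ≟₂ (b , a)))) refl
  where
  _≟₂_ : (x y : Hub × Hub) → Dec (x ≡ y)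
  _≟₂_ = ×-≡-dec _≟_ _≟_

-- The certificate is only a guess, read off the multiplicities of the hub pairs (direct edge plus subdivision
-- vertices): a pair of multiplicity three closes off a component; a double pair and the opposite one are cut
-- apart by the two simple pairs, one of them carrying s; otherwise the hubs span a K₄ whose triangle avoiding
-- the direct edge is fully subdivided.
mult : Config → Pair → ℕ
mult c p = indicator (lookup (Config.direct c) p) + ∑[ k < 5 ] indicator (does (lookup (attach c) k ≟ p))

inside : Config → Pair → Fin 9 → Bool
inside c p v = [ (λ h → h ∈ᵖ p) , (λ k → does (lookup (attach c) k ≟ p)) ]′ (splitAt 4 v)

subOn : Config → Pair → Sub
subOn c p = choose (λ k → lookup (attach c) k ≟ p) 0F

cutCertificate : Config → Pair → Certificate 9
cutCertificate c double =
  cut (sub s) (hub (inner e)) (hub (outer e)) (hub (inner o)) a′ (hub (outer o)) c′ (inside c double) (inside c (complement double))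
  where
  s : Sub
  s = choose (λ k → mult c (lookup (attach c) k) ℕ.≟ 1) 0F
  e o : Pair
  e = lookup (attach c) s
  o = choose (λ p → (mult c p ℕ.≟ 1) ×-dec ¬? (p ≟ e)) 0F
  inner outer : Pair → Hub
  inner p = if proj₁ (ends p) ∈ᵖ double then proj₁ (ends p) else proj₂ (ends p)
  outer p = if proj₁ (ends p) ∈ᵖ double then proj₂ (ends p) else proj₁ (ends p)
  a′ c′ : Fin 9
  a′ = if lookup (Config.direct c) o then hub (outer o) else sub (subOn c o)
  c′ = if lookup (Config.direct c) o then hub (inner o) else sub (subOn c o)

triangleCertificate : Config → Pair → Certificate 9
triangleCertificate c r = triangle (on x z) (on z w) (on x w) (hub x) (hub z) (hub w)
  where
  x z w : Hub
  x = proj₁ (ends r)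
  z = proj₁ (ends (complement r))
  w = proj₂ (ends (complement r))
  on : Hub → Hub → Fin 9
  on u v = sub (subOn c (pairOf u v))

certificate : Config → Certificate 9
certificate c with any? (λ p → 3 ≤? mult c p)
... | yes (heavy , _) = disconnected (hub (proj₁ (ends heavy))) (hub (proj₁ (ends (complement heavy)))) (inside c heavy)
... | no _ with any? (λ p → mult c p ℕ.≟ 2)
...   | yes (double , _) = cutCertificate c double
...   | no _ = triangleCertificate c (choose (λ p → lookup (Config.direct c) p Bool.≟ true) 0F)

load : Vec Pair n → Hub → ℕ
load {n} ps h = ∑[ k < n ] indicator (h ∈ᵖ lookup ps k)

hubDegree : Vec Bool 6 → Hub → ℕ
hubDegree d h = ∑[ b < 4 ] indicator (hubAdj d h b)

quota : Vec Bool 6 → Hub → ℕ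
quota d h = 3 ∸ hubDegree d h

fits : Pair → (Hub → ℕ) → Bool
fits p cap = (1 ≤ᵇ cap (proj₁ (ends p))) ∧ (1 ≤ᵇ cap (proj₂ (ends p)))

remove : Pair → (Hub → ℕ) → Hub → ℕ
remove p cap h = cap h ∸ indicator (h ∈ᵖ p)

allAttachments : ∀ n → (Hub → ℕ) → (Vec Pair n → Bool) → Bool
allAttachments zero cap k = if allᵇ (λ h → cap h ≡ᵇ 0) then k [] else true
allAttachments (suc n) cap k =
  allᵇ λ p → if fits p cap then allAttachments n (remove p cap) (λ ps → k (p ∷ ps)) else true

certified : Config → Bool
certified c = does (valid? (configAdj c) (certificate c))

-- Ranges over all sets of direct hub edges and all attachments giving every hub degree three.
everyConfigCertified : allBoolVecs 6 (λ d → allAttachments 5 (quota d) (λ ps → certified (config d ps))) ≡ true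
everyConfigCertified = refl

first∈ᵖ : ∀ p → proj₁ (ends p) ∈ᵖ p ≡ true
first∈ᵖ p = ∨-trueˡ (==-refl (proj₁ (ends p)))

second∈ᵖ : ∀ p → proj₂ (ends p) ∈ᵖ p ≡ true
second∈ᵖ p = ∨-trueʳ (proj₂ (ends p) == proj₁ (ends p)) (==-refl (proj₂ (ends p)))

allAttachments-sound : ∀ n cap (k : Vec Pair n → Bool) → allAttachments n cap k ≡ true →
                    ∀ ps → (∀ h → load ps h ≡ cap h) → k ps ≡ true
allAttachments-sound zero cap k ok [] load≡cap =
  subst (λ b → (if b then k [] else true) ≡ true)
        (allᵇ-complete (λ h → cap h ≡ᵇ 0) (λ h → T⇒true (≡⇒≡ᵇ (cap h) 0 (sym (load≡cap h))))) ok
allAttachments-sound (suc n) cap k ok (p ∷ ps) load≡cap =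
  allAttachments-sound n (remove p cap) (λ ps → k (p ∷ ps)) continue ps load≡remove
  where
  load≡remove : ∀ h → load ps h ≡ remove p cap h
  load≡remove h =
    sym (trans (cong (_∸ indicator (h ∈ᵖ p)) (sym (load≡cap h))) (m+n∸m≡n (indicator (h ∈ᵖ p)) (load ps h)))
  positive : ∀ h → h ∈ᵖ p ≡ true → (1 ≤ᵇ cap h) ≡ true
  positive h h∈p =
    T⇒true (≤⇒≤ᵇ (subst (1 ≤_) (load≡cap h) (subst (λ b → 1 ≤ indicator b + load ps h) (sym h∈p) (s≤s z≤n))))
  p-fits : fits p cap ≡ true
  p-fits = cong₂ _∧_ (positive _ (first∈ᵖ p)) (positive _ (second∈ᵖ p))
  continue : allAttachments n (remove p cap) (λ ps → k (p ∷ ps)) ≡ true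
  continue = subst (λ b → (if b then allAttachments n (remove p cap) (λ ps → k (p ∷ ps)) else true) ≡ true) p-fits
               (allᵇ-sound (λ p → if fits p cap then allAttachments n (remove p cap) (λ ps → k (p ∷ ps)) else true) ok p)

distinctFrom : ∀ {n} (x y : Fin (3 + n)) → ∃ λ z → z ≢ x × z ≢ y
distinctFrom x y with 0F ≟ x | 0F ≟ y | 1F ≟ x | 1F ≟ y
... | no 0≢x | no 0≢y | _ | _ = 0F , 0≢x , 0≢y
... | _ | _ | no 1≢x | no 1≢y = 1F , 1≢x , 1≢y
... | yes refl | _ | _ | yes refl = 2F , (λ ()) , (λ ())
... | _ | yes refl | yes refl | _ = 2F , (λ ()) , (λ ())
... | no _ | yes refl | no _ | yes ()

module _ {n : ℕ} (G : Graph (3 + n)) (connected-G : Connected G) where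
  open Degrees G
  open Neighbours G

  pendant-refutation : ∀ v → deg v ≤ 1 → Σ (Triple (3 + n)) λ S → ¬ TwoPacking G S
  pendant-refutation v deg≤1 with distinctFrom v v
  ... | w₁ , w₁≢v , _ with distinctFrom v w₁
  ...   | w₂ , w₂≢v , w₂≢w₁ =
    triple v w₁ w₂ (≢-sym w₁≢v) (≢-sym w₂≢v) (≢-sym w₂≢w₁) ,
    ¬twoPacking-pendant (inj₁ refl) (deg≤1-neighbours deg≤1 (proj₂ (firstStep (connected-G v w₁) (≢-sym w₁≢v))))
    where
    firstStep : ∀ {u w} → Walk (Adj G) u w → u ≢ w → ∃ λ t → Adj G u t ≡ true
    firstStep here u≢u = ⊥-elim (u≢u refl)
    firstStep (step e _) _ = _ , e

  adjacent-refutation : ∀ v x → deg v ≡ 2 → deg x ≡ 2 → Adj G v x ≡ true → Σ (Triple (3 + n)) λ S → ¬ TwoPacking G S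
  adjacent-refutation v x deg-v deg-x adj with distinctFrom v x
  ... | w , w≢v , w≢x =
    triple v x w v≢x (≢-sym w≢v) (≢-sym w≢x) ,
    ¬twoPacking-adjacentPair (inj₁ refl) (inj₂ (inj₁ refl)) (inj₂ (inj₂ refl)) w≢v w≢x
      (proj₂ (otherNeighbour deg-v adj)) (proj₂ (otherNeighbour deg-x (trans (Adj-sym G x v) adj)))
    where
    v≢x : v ≢ x
    v≢x refl = true≢false (trans (sym adj) (Adj-irrefl G v))
    otherNeighbour : ∀ {s t} → deg s ≡ 2 → Adj G s t ≡ true → ∃ λ y → NeighboursWithin (Adj G) s t y
    otherNeighbour deg-s e with deg≡2-neighbours deg-s
    ... | p , q , _ , _ , _ , N with N _ e
    ...   | inj₁ refl = q , N
    ...   | inj₂ refl = p , λ y e′ → ⊎-swap (N y e′)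

module CubicSubdivision (G : Graph 9) (connected-G : Connected G) (edges : numEdges G ≡ 11)
                        (minDeg : ∀ v → 2 ≤ Degrees.deg G v)
                        (independent : ∀ v w → Degrees.deg G v ≡ 2 → Degrees.deg G w ≡ 2 → Adj G v w ≡ false) where
  open Degrees G
  open DegreeTwo G
  open NineVerticesElevenEdges G edges
  open Neighbours G

  hubList subList : List (Fin 9)
  hubList = filter (λ v → T? (not (isDeg2 v))) (allFin 9)
  subList = filter (λ v → T? (isDeg2 v)) (allFin 9)

  private
    module H = Enumeration hubList (trans (sumᴸ-filter (λ v → T? (not (isDeg2 v))) (allFin 9))
                                          (trans (sumᴸ-tabulate 𝟙other (λ v → v)) (∑𝟙other≡4 minDeg independent)))
    module D = Enumeration subList (trans (sumᴸ-filter (λ v → T? (isDeg2 v)) (allFin 9))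
                                          (trans (sumᴸ-tabulate 𝟙deg2 (λ v → v)) (∑𝟙deg2≡5 minDeg independent)))

  -- Opaque, because with-abstractions over goals mentioning them would otherwise normalise the filtered lists.
  opaque
    hubAt : Hub → Fin 9
    hubAt = H.at

    subAt : Sub → Fin 9
    subAt = D.at

    hubAt-isDeg2 : ∀ h → isDeg2 (hubAt h) ≡ false
    hubAt-isDeg2 h = not-true (T⇒true (H.at-All (All.all-filter (λ v → T? (not (isDeg2 v))) (allFin 9)) h))
      where
      not-true : ∀ {b} → not b ≡ true → b ≡ false
      not-true {false} _ = refl

    hubAt-injective : ∀ {a b} → hubAt a ≡ hubAt b → a ≡ b
    hubAt-injective = H.at-injective (Unique.filter⁺ (λ v → T? (not (isDeg2 v))) {allFin 9} (Unique.allFin⁺ 9))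

    subAt-injective : ∀ {k l} → subAt k ≡ subAt l → k ≡ l
    subAt-injective = D.at-injective (Unique.filter⁺ (λ v → T? (isDeg2 v)) {allFin 9} (Unique.allFin⁺ 9))

    subAt-deg : ∀ k → deg (subAt k) ≡ 2
    subAt-deg k = isDeg2⇒≡2 (T⇒true (D.at-All (All.all-filter (λ v → T? (isDeg2 v)) (allFin 9)) k))

    hubOf : ∀ {x} → isDeg2 x ≡ false → ∃ λ h → hubAt h ≡ x
    hubOf {x} x≢2 = H.at-surjective (∈-filter⁺ (λ v → T? (not (isDeg2 v))) (∈-allFin x) (T-true (cong not x≢2)))

    subOf : ∀ {x} → isDeg2 x ≡ true → ∃ λ k → subAt k ≡ x
    subOf {x} x≡2 = D.at-surjective (∈-filter⁺ (λ v → T? (isDeg2 v)) (∈-allFin x) (T-true x≡2))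

  ρ : Fin 9 → Fin 9
  ρ i = [ hubAt , subAt ]′ (splitAt 4 i)

  ρ-injective : ∀ {i j} → ρ i ≡ ρ j → i ≡ j
  ρ-injective {i} {j} eq =
    trans (sym (join-splitAt 4 5 i)) (trans (cong (join 4 5) (injective⊎ (splitAt 4 i) (splitAt 4 j) eq)) (join-splitAt 4 5 j))
    where
    kinds-differ : ∀ h k → hubAt h ≢ subAt k
    kinds-differ h k eq = true≢false (trans (sym (≡2⇒isDeg2 (subAt-deg k))) (subst (λ x → isDeg2 x ≡ false) eq (hubAt-isDeg2 h)))
    injective⊎ : ∀ x y → [ hubAt , subAt ]′ x ≡ [ hubAt , subAt ]′ y → x ≡ y
    injective⊎ (inj₁ a) (inj₁ b) eq = cong inj₁ (hubAt-injective eq)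
    injective⊎ (inj₂ k) (inj₂ l) eq = cong inj₂ (subAt-injective eq)
    injective⊎ (inj₁ h) (inj₂ k) eq = ⊥-elim (kinds-differ h k eq)
    injective⊎ (inj₂ k) (inj₁ h) eq = ⊥-elim (kinds-differ h k (sym eq))

  ρ-surjective : ∀ x → ∃ λ i → ρ i ≡ x
  ρ-surjective x with isDeg2 x in x≟2
  ... | false = let h , hubAt-h≡x = hubOf x≟2 in hub h , trans (cong [ hubAt , subAt ]′ (splitAt-↑ˡ 4 h 5)) hubAt-h≡x
  ... | true = let k , subAt-k≡x = subOf x≟2 in sub k , trans (cong [ hubAt , subAt ]′ (splitAt-↑ʳ 4 5 k)) subAt-k≡x

  direct : Vec Bool 6
  direct = Vec.tabulate λ p → Adj G (hubAt (proj₁ (ends p))) (hubAt (proj₂ (ends p)))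

  hubs-realises : ∀ a b → Adj G (hubAt a) (hubAt b) ≡ hubAdj direct a b
  hubs-realises a b with a ≟ b
  ... | yes refl = Adj-irrefl G (hubAt a)
  ... | no a≢b = trans (oriented (ends-pairOf a b a≢b))
                       (sym (lookup∘tabulate (λ p → Adj G (hubAt (proj₁ (ends p))) (hubAt (proj₂ (ends p)))) (pairOf a b)))
    where
    oriented : ends (pairOf a b) ≡ (a , b) ⊎ ends (pairOf a b) ≡ (b , a) →
               Adj G (hubAt a) (hubAt b) ≡ Adj G (hubAt (proj₁ (ends (pairOf a b)))) (hubAt (proj₂ (ends (pairOf a b))))
    oriented (inj₁ eq) = cong (λ e → Adj G (hubAt (proj₁ e)) (hubAt (proj₂ e))) (sym eq)
    oriented (inj₂ eq) = trans (Adj-sym G (hubAt a) (hubAt b)) (cong (λ e → Adj G (hubAt (proj₁ e)) (hubAt (proj₂ e))) (sym eq))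

  private
    hubNeighbour : ∀ {k y} → Adj G (subAt k) y ≡ true → ∃ λ h → hubAt h ≡ y
    hubNeighbour {k} {y} e with isDeg2 y in y≟2
    ... | false = hubOf y≟2
    ... | true = ⊥-elim (true≢false (trans (sym e) (independent (subAt k) y (subAt-deg k) (isDeg2⇒≡2 y≟2))))

  attachOf : Sub → Pair
  attachOf k with deg≡2-neighbours (subAt-deg k)
  ... | p , q , _ , Ap , Aq , _ = pairOf (proj₁ (hubNeighbour Ap)) (proj₁ (hubNeighbour Aq))

  subs-realises : ∀ k c → Adj G (subAt k) (hubAt c) ≡ c ∈ᵖ attachOf k
  subs-realises k c with deg≡2-neighbours (subAt-deg k)
  ... | p , q , p≢q , Ap , Aq , N[s] with hubNeighbour Ap | hubNeighbour Aq
  ...   | a , refl | b , refl = trans (which (c ≟ a) (c ≟ b)) (sym (∈ᵖ-pairOf a b c λ a≡b → p≢q (cong hubAt a≡b)))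
    where
    which : (c≟a : Dec (c ≡ a)) (c≟b : Dec (c ≡ b)) → Adj G (subAt k) (hubAt c) ≡ does c≟a ∨ does c≟b
    which (yes c≡a) _ = subst (λ x → Adj G (subAt k) (hubAt x) ≡ true) (sym c≡a) Ap
    which (no _) (yes c≡b) = subst (λ x → Adj G (subAt k) (hubAt x) ≡ true) (sym c≡b) Aq
    which (no c≢a) (no c≢b) with Adj G (subAt k) (hubAt c) in e
    ... | false = refl
    ... | true with N[s] (hubAt c) e
    ...   | inj₁ eq = ⊥-elim (c≢a (hubAt-injective eq))
    ...   | inj₂ eq = ⊥-elim (c≢b (hubAt-injective eq))

  configuration : Config
  configuration = config direct (Vec.tabulate attachOf)

  realises⊎ : ∀ x y → Adj G ([ hubAt , subAt ]′ x) ([ hubAt , subAt ]′ y) ≡ adj⊎ configuration x y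
  realises⊎ (inj₁ a) (inj₁ b) = hubs-realises a b
  realises⊎ (inj₁ a) (inj₂ k) = trans (Adj-sym G (hubAt a) (subAt k)) (realises⊎ (inj₂ k) (inj₁ a))
  realises⊎ (inj₂ k) (inj₁ a) = trans (subs-realises k a) (cong (a ∈ᵖ_) (sym (lookup∘tabulate attachOf k)))
  realises⊎ (inj₂ k) (inj₂ l) = independent (subAt k) (subAt l) (subAt-deg k) (subAt-deg l)

  realises : ∀ i j → Adj G (ρ i) (ρ j) ≡ configAdj configuration i j
  realises i j = realises⊎ (splitAt 4 i) (splitAt 4 j)

  open Relabelling G ρ ρ-injective ρ-surjective (configAdj configuration) realises

  load≡quota : ∀ h → load (Vec.tabulate attachOf) h ≡ quota direct h
  load≡quota h = sym (trans (cong (_∸ hubDegree direct h) degree≡) (m+n∸m≡n (hubDegree direct h) _))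
    where
    row : Fin 9 → ℕ
    row i = indicator (adj⊎ configuration (inj₁ h) (splitAt 4 i))
    degree≡ : 3 ≡ hubDegree direct h + load (Vec.tabulate attachOf) h
    degree≡ = begin
      3
        ≡⟨ sym (other⇒deg≡3 minDeg independent (hubAt h) (hubAt-isDeg2 h)) ⟩
      ∑[ x < 9 ] indicator (Adj G (hubAt h) x)
        ≡⟨ ∑-permute (λ x → indicator (Adj G (hubAt h) x)) (permutation ρ σ ρσ σρ) ⟩
      ∑[ i < 9 ] indicator (Adj G (hubAt h) (ρ i))
        ≡⟨ sum-cong-≗ (λ i → cong indicator (realises⊎ (inj₁ h) (splitAt 4 i))) ⟩
      ∑[ i < 9 ] row i
        ≡⟨ ∑-splitAt 4 row ⟩
      ∑[ b < 4 ] row (b ↑ˡ 5) + ∑[ k < 5 ] row (4 ↑ʳ k)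
        ≡⟨ cong₂ _+_ (sum-cong-≗ λ b → cong (λ x → indicator (adj⊎ configuration (inj₁ h) x)) (splitAt-↑ˡ 4 b 5))
                     (sum-cong-≗ λ k → cong (λ x → indicator (adj⊎ configuration (inj₁ h) x)) (splitAt-↑ʳ 4 5 k)) ⟩
      hubDegree direct h + load (Vec.tabulate attachOf) h ∎
      where open ≡-Reasoning

  refutation : Σ (Triple 9) λ S → ¬ TwoPacking G S
  refutation = certificate-sound connected-G (certificate configuration)
                 (dec-true⁻¹ (valid? (configAdj configuration) (certificate configuration)) certifiedG)
    where
    certifiedG : certified configuration ≡ true
    certifiedG = allAttachments-sound 5 (quota direct) (λ ps → certified (config direct ps))
                 (allBoolVecs-sound 6 (λ d → allAttachments 5 (quota d) (λ ps → certified (config d ps))) everyConfigCertified direct)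
                 (Vec.tabulate attachOf) load≡quota

noTwoPacking : (G : Graph 9) → Connected G → numEdges G ≡ 11 → Σ (Triple 9) λ S → ¬ TwoPacking G S
noTwoPacking G connected-G edges with any? (λ v → Degrees.deg G v ≤? 1)
... | yes (v , deg≤1) = pendant-refutation G connected-G v deg≤1
... | no noLeaf
  with any? (λ v → any? λ x → (Degrees.deg G v ℕ.≟ 2) ×-dec (Degrees.deg G x ℕ.≟ 2) ×-dec (Adj G v x Bool.≟ true))
...   | yes (v , x , deg-v , deg-x , adj) = adjacent-refutation G connected-G v x deg-v deg-x adj
...   | no noAdjacent = CubicSubdivision.refutation G connected-G edges minDeg independent
  where
  minDeg : ∀ v → 2 ≤ Degrees.deg G v
  minDeg v = ≰⇒> (λ deg≤1 → noLeaf (v , deg≤1))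
  independent : ∀ v w → Degrees.deg G v ≡ 2 → Degrees.deg G w ≡ 2 → Adj G v w ≡ false
  independent v w deg-v deg-w with Adj G v w in adj
  ... | false = refl
  ... | true = ⊥-elim (noAdjacent (v , w , deg-v , deg-w , adj))

lemma4 : (G : Graph 9) → Connected G → numEdges G ≡ 11 → IsKappa3 G 1
lemma4 G connected-G edges = isKappa3-one G connected-G (noTwoPacking G connected-G edges)
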